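{- Let $\mathcal{S}^2(\mathbb{F}_5^3)$ be the set of symmetric $3\times 3$ matrices over $\mathbb{F}_5$ (there are $15625$ of them). The numbers of elements of symmetric rank $0,1,2,3,4$ are $1,62,1922,7440,6200$ respectively; in particular every element is a sum of simple symmetric tensors and the maximum symmetric rank is $4$.
   Context: A simple symmetric tensor of order $2$ over $\mathbb{F}$ is $uu^T$ with $u\in\mathbb{F}^3$ nonzero. The symmetric rank of a symmetric matrix $X$ is the least $s$ such that $X=\sum_{i=1}^s u_iu_i^T$ with the $u_i$ nonzero; the zero matrix has symmetric rank $0$. -}

module Defs where

open import Data.Nat using (ℕ; zero; suc; _<_)
import Data.Nat as ℕ
open import Data.Nat.DivMod using (_mod_)
open import Data.Fin using (Fin; toℕ)
open import Data.Vec using (Vec; lookup; tabulate; replicate)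
open import Data.List using (List; []; _∷_; length; foldr)
open import Data.List.Relation.Unary.All using (All)
open import Data.Product using (Σ; _×_; _,_)
open import Relation.Binary.PropositionalEquality using (_≡_; _≢_)
open import Relation.Nullary using (¬_)

F₅ : Set
F₅ = Fin 5

_+F_ : F₅ → F₅ → F₅
a +F b = (toℕ a ℕ.+ toℕ b) mod 5

_*F_ : F₅ → F₅ → F₅
a *F b = (toℕ a ℕ.* toℕ b) mod 5

0F : F₅
0F = Data.Fin.zero

Vec3 : Set
Vec3 = Vec F₅ 3

Mat3 : Set
Mat3 = Vec (Vec F₅ 3) 3

entry : Mat3 → Fin 3 → Fin 3 → F₅
entry M i j = lookup (lookup M i) j

Symmetric : Mat3 → Set
Symmetric M = ∀ i j → entry M i j ≡ entry M j i

zeroMat : Mat3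
zeroMat = replicate 3 (replicate 3 0F)

_+M_ : Mat3 → Mat3 → Mat3
A +M B = tabulate λ i → tabulate λ j → entry A i j +F entry B i j

outer : Vec3 → Mat3
outer u = tabulate λ i → tabulate λ j → lookup u i *F lookup u j

NonZeroVec : Vec3 → Set
NonZeroVec u = u ≢ replicate 3 0F

sumOuter : List Vec3 → Mat3
sumOuter us = foldr (λ u acc → outer u +M acc) zeroMat us

SumOfSimple : ℕ → Mat3 → Set
SumOfSimple s X =
  Σ (List Vec3) λ us → length us ≡ s × All NonZeroVec us × sumOuter us ≡ X

SymRank : Mat3 → ℕ → Set
SymRank X r = SumOfSimple r X × (∀ s → s < r → ¬ SumOfSimple s X)

open import Data.List.Membership.Propositional using (_∈_)
open import Data.List.Relation.Unary.Unique.Propositional using (Unique)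
open import Function.Bundles using (_⇔_)

NumberWithSymRank : ℕ → ℕ → Set
NumberWithSymRank r n =
  Σ (List Mat3) λ L → length L ≡ n × Unique L
    × ((X : Mat3) → (X ∈ L) ⇔ (Symmetric X × SymRank X r))

-- The symmetric rank is computed by a candidate function ρ on the 5⁶ symmetric matrices,
-- certified by two finite facts. Each X is stored together with a decomposition into ρ X simple
-- tensors uuᵀ, so its symmetric rank is at most ρ X. Conversely ρ 0 = 0 and
-- ρ (uuᵀ + X) ≤ ρ X + 1 for every u (trivially so once ρ X ≥ 3, as ρ ≤ 4), hence by induction on
-- the number of summands no sum of fewer than ρ X simple tensors equals X. Both facts, and the
-- number of matrices on which ρ takes each value, are checked by evaluation.

module Submission where

open import Defs
open import Data.Nat using (ℕ; zero; suc; _≤_; _≤?_; _≟_; _/_; _%_; _∸_; z≤n; s≤s)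
open import Data.Nat.Properties using (≤-trans; ≤-antisym; ≮⇒≥; <-≤-trans; <-irrefl)
open import Data.Nat.DivMod using (_mod_)
open import Data.Fin using (Fin) renaming (zero to fz; suc to fs)
import Data.Fin.Properties as Fin
open import Data.Vec using (Vec; []; _∷_; lookup; replicate)
import Data.Vec.Properties as Vec
open import Data.Bool using (T)
open import Data.Bool.ListAction using (all)
open import Data.List using (List; []; _∷_; length; map; filter; cartesianProductWith; allFin)
open import Data.List.Properties using (length-map)
open import Data.List.Relation.Unary.All using (All; all?; [])
open import Data.List.Relation.Unary.AllPairs using ([]; _∷_)
import Data.List.Relation.Unary.All as All
import Data.List.Relation.Unary.All.Properties as All
open import Data.List.Relation.Unary.Any using (here)
open import Data.List.Membership.Propositional using (_∈_)
open import Data.List.Membership.Propositional.Properties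
  using (∈-map⁻; ∈-filter⁻; ∈-map∘filter⁺; ∈-cartesianProductWith⁺; ∈-allFin)
open import Data.List.Relation.Unary.Unique.Propositional using (Unique)
import Data.List.Relation.Unary.Unique.Propositional.Properties as Unique
open import Data.Product using (∃; _×_; _,_; proj₁; proj₂)
open import Data.Sum using (_⊎_; inj₁; inj₂)
open import Function.Bundles using (mk⇔)
open import Relation.Binary.Definitions using (DecidableEquality)
open import Relation.Binary.PropositionalEquality using (_≡_; refl; sym; trans; cong; subst)
open import Relation.Nullary.Decidable using (Dec; isYes; ¬?; _×-dec_; _⊎-dec_; toWitness)

vectors : ∀ {m} n → List (Vec (Fin m) n)
vectors zero = [] ∷ []
vectors (suc n) = cartesianProductWith _∷_ (allFin _) (vectors n)

vectors-unique : ∀ {m} n → Unique (vectors {m} n)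
vectors-unique zero = [] ∷ []
vectors-unique (suc n) =
  Unique.cartesianProductWith⁺ _∷_ Vec.∷-injective (Unique.allFin⁺ _) (vectors-unique n)

∈-vectors : ∀ {m n} (v : Vec (Fin m) n) → v ∈ vectors n
∈-vectors [] = here refl
∈-vectors (a ∷ v) = ∈-cartesianProductWith⁺ _∷_ (∈-allFin a) (∈-vectors v)

all-isYes⇒All : ∀ {A : Set} {P : A → Set} (P? : ∀ x → Dec (P x)) xs →
                T (all (λ x → isYes (P? x)) xs) → All P xs
all-isYes⇒All P? xs holds = All.map (λ {x} → toWitness {a? = P? x}) (All.all⁺ _ xs holds)

module _ (ρ : Mat3 → ℕ) (ρ-zero : ρ zeroMat ≡ 0)
         (ρ-step : ∀ u X → ρ (outer u +M X) ≤ suc (ρ X)) where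

  ρ-sumOuter : ∀ us → ρ (sumOuter us) ≤ length us
  ρ-sumOuter [] = subst (_≤ 0) (sym ρ-zero) z≤n
  ρ-sumOuter (u ∷ us) = ≤-trans (ρ-step u (sumOuter us)) (s≤s (ρ-sumOuter us))

  sumOfSimple-lowerBound : ∀ {s X} → SumOfSimple s X → ρ X ≤ s
  sumOfSimple-lowerBound (us , refl , _ , refl) = ρ-sumOuter us

symRank-intro : ∀ {X r} → SumOfSimple r X → (∀ {s} → SumOfSimple s X → r ≤ s) → SymRank X r
symRank-intro sum minimal = sum , λ s s<r sum′ → <-irrefl refl (<-≤-trans s<r (minimal sum′))

symRank-unique : ∀ {X r r′} → SymRank X r → SymRank X r′ → r ≡ r′
symRank-unique (sum , minimal) (sum′ , minimal′) =
  ≤-antisym (≮⇒≥ (λ r′<r → minimal _ r′<r sum′)) (≮⇒≥ (λ r<r′ → minimal′ _ r<r′ sum))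

SymCoords : Set
SymCoords = Vec F₅ 6

symCoords : Mat3 → SymCoords
symCoords X = entry X fz fz ∷ entry X fz (fs fz) ∷ entry X fz (fs (fs fz))
  ∷ entry X (fs fz) (fs fz) ∷ entry X (fs fz) (fs (fs fz)) ∷ entry X (fs (fs fz)) (fs (fs fz)) ∷ []

fromSymCoords : SymCoords → Mat3
fromSymCoords (a ∷ b ∷ c ∷ d ∷ e ∷ f ∷ []) =
  (a ∷ b ∷ c ∷ []) ∷ (b ∷ d ∷ e ∷ []) ∷ (c ∷ e ∷ f ∷ []) ∷ []

fromSymCoords-symmetric : ∀ k → Symmetric (fromSymCoords k)
fromSymCoords-symmetric (_ ∷ _ ∷ _ ∷ _ ∷ _ ∷ _ ∷ []) fz fz = refl
fromSymCoords-symmetric (_ ∷ _ ∷ _ ∷ _ ∷ _ ∷ _ ∷ []) fz (fs fz) = refl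
fromSymCoords-symmetric (_ ∷ _ ∷ _ ∷ _ ∷ _ ∷ _ ∷ []) fz (fs (fs fz)) = refl
fromSymCoords-symmetric (_ ∷ _ ∷ _ ∷ _ ∷ _ ∷ _ ∷ []) (fs fz) fz = refl
fromSymCoords-symmetric (_ ∷ _ ∷ _ ∷ _ ∷ _ ∷ _ ∷ []) (fs fz) (fs fz) = refl
fromSymCoords-symmetric (_ ∷ _ ∷ _ ∷ _ ∷ _ ∷ _ ∷ []) (fs fz) (fs (fs fz)) = refl
fromSymCoords-symmetric (_ ∷ _ ∷ _ ∷ _ ∷ _ ∷ _ ∷ []) (fs (fs fz)) fz = refl
fromSymCoords-symmetric (_ ∷ _ ∷ _ ∷ _ ∷ _ ∷ _ ∷ []) (fs (fs fz)) (fs fz) = refl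
fromSymCoords-symmetric (_ ∷ _ ∷ _ ∷ _ ∷ _ ∷ _ ∷ []) (fs (fs fz)) (fs (fs fz)) = refl

fromSymCoords-injective : ∀ {k k′} → fromSymCoords k ≡ fromSymCoords k′ → k ≡ k′
fromSymCoords-injective {_ ∷ _ ∷ _ ∷ _ ∷ _ ∷ _ ∷ []} {_ ∷ _ ∷ _ ∷ _ ∷ _ ∷ _ ∷ []} refl = refl

symCoords-fromSymCoords : ∀ k → symCoords (fromSymCoords k) ≡ k
symCoords-fromSymCoords (_ ∷ _ ∷ _ ∷ _ ∷ _ ∷ _ ∷ []) = refl

fromSymCoords-symCoords : ∀ {X} → Symmetric X → fromSymCoords (symCoords X) ≡ X
fromSymCoords-symCoords {(a ∷ b ∷ c ∷ []) ∷ (b′ ∷ d ∷ e ∷ []) ∷ (c′ ∷ e′ ∷ f ∷ []) ∷ []} S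
  with S (fs fz) fz | S (fs (fs fz)) fz | S (fs (fs fz)) (fs fz)
... | refl | refl | refl = refl

v5 : {A : Set} → A → A → A → A → A → Vec A 5
v5 a b c d e = a ∷ b ∷ c ∷ d ∷ e ∷ []

Trie : ℕ → Set
Trie zero = ℕ
Trie (suc n) = Vec (Trie n) 5

lookupTrie : ∀ {n} → Trie n → Vec F₅ n → ℕ
lookupTrie t [] = t
lookupTrie t (a ∷ k) = lookupTrie (lookup t a) k

-- The entry of the table at ⟨a, b, c, d, e, f⟩ encodes a decomposition u₁ … u_r of
-- fromSymCoords ⟨a, b, c, d, e, f⟩ as the base-126 numeral whose digits, least significant first,
-- are 1 + code uᵢ, where code ⟨x, y, z⟩ = x + 5y + 25z.
table00 : Trie 4
table00 = v5 (v5 (v5 (v5 0 26 3302 6477 51) (v5 5237 1417 4582 7117 822) (v5 3972 792 5212 7757 1442) (v5 5857 797 3942 7122 1457) (v5 4592 1432 3947 8387 817)) (v5 (v5 6 782 98558 101733 807) (v5 3957 31 3307 102373 96078) (v5 3332 96048 100468 6482 56) (v5 3347 96053 99198 6497 71) (v5 5847 46 3322 103643 96073)) (v5 (v5 762 96038 3952 7127 96063) (v5 5852 787 98563 9017 176088) (v5 5867 176058 3937 101738 812) (v5 3962 176063 5842 101753 827) (v5 3977 802 98578 7112 176083)) (v5 (v5 1397 176048 4577 7752 176073) (v5 4597 96043 5207 104273 1452) (v5 5227 1422 99193 8382 96068) (v5 4602 1427 101098 7747 96083) (v5 5232 96058 4572 102368 1447)) (v5 (v5 11 1412 99833 103008 1437)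 (v5 3342 176053 100463 6492 66) (v5 4587 36 3312 103638 176078) (v5 5217 41 3317 103003 176093) (v5 3337 176068 99828 6487 61))) (v5 (v5 (v5 3709 405 3558 6605 306) (v5 5619 1670 4838 7245 951) (v5 4354 1171 5718 7885 1571) (v5 6239 1050 4198 7375 1964) (v5 4974 1811 4453 8640 1324)) (v5 (v5 98965 48411 98814 101861 32562) (v5 35712 96926 51061 102501 96207) (v5 51086 96427 100974 38612 96827) (v5 51101 96306 99454 38627 97220) (v5 37602 97067 51076 103896 96580)) (v5 (v5 12101221 4128921 4036837 6056391 4096818) (v5 4038610 6050048 4147449 12104757 4192971) (v5 6055128 4208815 12103230 4102868 4033571) (v5 6053223 4224822 12101710 4102883 4033712) (v5 4036735 6049685 4131588 12106152 4224970)) (v5 (v5 22182481 4208931 4037462 6057016 4176828) (v5 6053858 4128800 14117452 4152781 4034337) (v5 4037985 6050683 4163830 14136250 4144955) (v5 4037360 6050310 4118107 16137021 4112966) (v5 6054493 4144817 14149094 4135000 4034206)) (v5 (v5 178345 49041 131586 118887 33192) (v5 51096 176306 132216 38622 112587) (v5 36342 144307 51066 119517 176207) (v5 36972 128436 51071 166510 176600) (v5 51091 176447 147457 38617 160210))) (v5 (v5 (v5 3456 280 3684 6733 430) (v5 5366 1923 5089 7373 1075) (v5 4101 920 5594 8013 1695) (v5 5986 1303 4449 7628 1836) (v5 4721 1560 4329 8893 1196)) (v5 (v5 98712 32536 98940 101989 48436) (v5 51586 97179 35311 102629 96331) (v5 35336 96176 100850 54236 96951) (v5 35351 96559 99705 54251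 97092) (v5 53476 96816 35326 104149 96452)) (v5 (v5 12100968 4096792 6052835 4040012 4128946) (v5 6055116 4033671 4099567 12104885 4224847) (v5 4038751 4192940 12103106 4150624 6050073) (v5 4036846 4224949 12101961 4134763 6049710) (v5 6053241 4033560 4099582 12106405 4208840)) (v5 (v5 22182228 4176802 6053460 4040637 4208956) (v5 4037481 4112925 16133450 4121282 6050335) (v5 6054491 4034306 4147955 14120627 4128825) (v5 6053866 4034185 4133984 14152269 4144842) (v5 4038116 4144944 14133469 4167005 6050708)) (v5 (v5 178092 33166 115961 134761 49066) (v5 35346 176559 163969 54246 128461) (v5 52216 112556 35316 135391 176331) (v5 52846 160189 35321 150632 176472) (v5 35341 176196 115706 54241 144332))) (v5 (v5 (v5 3833 281 3430 6606 433) (v5 5743 1546 4710 7496 1204) (v5 4478 1299 5465 8136 1824) (v5 6363 926 4070 7251 1713) (v5 5098 1939 4200 8516 1073)) (v5 (v5 99089 32537 98686 101862 48439) (v5 51589 96802 35437 102752 96460) (v5 35462 96555 100721 54614 97080) (v5 35477 96182 99326 54629 96969) (v5 53479 97195 35452 103772 96329)) (v5 (v5 12101345 4096793 6053216 4039885 4128949) (v5 6054735 4033546 4099693 12105008 4208848) (v5 4038626 4224945 12102977 4134371 6049698) (v5 4036721 4192946 12101582 4150262 6050091) (v5 6052860 4033687 4099708 12106028 4224845)) (v5 (v5 22182605 4176803 6053841 4040510 4208959) (v5 4037356 4144930 14133075 4168783 6050716) (v5 6054110 4034181 4131825 14152377 4144830) (v5 6053485 4034312 4149606 14120515 4128843)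 (v5 4037991 4112941 16133846 4119250 6050333)) (v5 (v5 178469 33167 115712 135264 49069) (v5 35472 176182 116342 54624 144340) (v5 52219 160185 35442 151270 176460) (v5 52849 112562 35447 134759 176349) (v5 35467 176575 163335 54619 128459))) (v5 (v5 (v5 3580 408 3431 6859 305) (v5 5490 1799 4961 7624 1328) (v5 4225 1048 5341 8264 1948) (v5 6110 1179 4321 7504 1585) (v5 4845 1688 4076 8769 945)) (v5 (v5 98836 48414 98687 102115 32561) (v5 35711 97055 51439 102880 96584) (v5 51464 96304 100597 38486 97204) (v5 51479 96435 99577 38501 96841) (v5 37601 96944 51454 104025 96201)) (v5 (v5 12101092 4128924 4036710 6056010 4096817) (v5 4038737 6049673 4131196 12105136 4224974) (v5 6054753 4224820 12102853 4102742 4033696) (v5 6052848 4208823 12101833 4102757 4033585) (v5 4036862 6050066 4147087 12106281 4192965)) (v5 (v5 22182352 4208934 4037335 6056635 4176827) (v5 6053483 4144805 14149202 4137159 4034210) (v5 4038112 6050308 4116075 16136625 4112950) (v5 4037487 6050691 4165608 14136644 4144969) (v5 6054118 4128818 14117340 4151130 4034331)) (v5 (v5 178216 49044 132089 119136 33191) (v5 51474 176435 148095 38496 160214) (v5 36341 128434 51444 167144 176584) (v5 36971 144315 51449 118881 176221) (v5 51469 176324 131584 38491 112581)))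

table01 : Trie 4
table01 = v5 (v5 (v5 (v5 1149 144800 16150974 16154149 144825) (v5 5365 33547 4037341 6056378 48576) (v5 4351 48546 6054473 4040516 33572) (v5 6113 48551 6053203 4039881 33587) (v5 5099 33562 4036706 6057648 48571)) (v5 (v5 385 48536 4115441 4118616 48561) (v5 4085 144805 6052568 4167009 128334) (v5 3711 128304 4165104 6055743 144830) (v5 3603 128309 4163834 6055383 144845) (v5 6354 144820 6052208 4168279 128329)) (v5 (v5 1018 128294 4036836 4040011 128319) (v5 5980 48541 4163199 16153514 192216) (v5 6246 192186 16151609 4166374 48566) (v5 4218 192191 16150339 4166264 48581) (v5 4484 48556 4163089 16154784 192211)) (v5 (v5 1525 192176 6053838 6057013 192201) (v5 4725 128299 16149704 4121156 33582) (v5 5606 33552 4116076 16152879 128324) (v5 4858 33557 4117981 16152519 128339) (v5 5739 128314 16149344 4119251 33577)) (v5 (v5 266 33542 4164469 4167644 33567) (v5 3470 192181 4117346 4039376 144840) (v5 4966 144810 4036071 4120521 192206) (v5 5473 144815 4036201 4119886 192221) (v5 3844 192196 4116711 4039246 144835))) (v5 (v5 (v5 4349 97047 12102345 14137520 112572) (v5 6054498 49046 5088 38872 4033581) (v5 51726 6050053 4038097 39887 1949) (v5 37612 1176 51696 6056386 4034216) (v5 4037350 6050315 51701 8515 32572)) (v5 (v5 99605 6049665 4115567 117612 936) (v5 51711 410 50936 4103128 4144965) (v5 6052593 4128805 132221 6735 97205) (v5 3729 96432 4148084 6055761 160220) (v5 6055108 128441 3578 103771 4096828)) (v5 (v5 12101861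 4144797 51706 7380 96192) (v5 6234 48416 4131323 16137641 176217) (v5 4038625 176311 4193 101991 4033697) (v5 51716 4208820 14118087 118007 1334) (v5 51731 1055 98834 12106027 4176838)) (v5 (v5 22183121 176427 4833 39882 4192956) (v5 36352 4128926 14149329 167780 1581) (v5 36982 1675 99449 12104247 4112951) (v5 6053863 6050688 132851 7875 96590) (v5 5614 96311 12101090 4150876 33202)) (v5 (v5 178985 1791 100089 4104138 4034322) (v5 4036100 4208936 148092 6620 96837) (v5 4969 96931 4036197 4136270 176585) (v5 4037975 144312 3823 103131 4224980) (v5 35092 4224827 4164465 38242 316))) (v5 (v5 (v5 5351 112546 14134599 12105520 97072) (v5 37241 4034175 6053465 54871 1201) (v5 6053236 4033550 37216 8263 49071) (v5 4038741 32551 4324 54876 6050340) (v5 52221 1938 35701 4041272 6050078)) (v5 (v5 100607 910 114436 4118742 6049690) (v5 4086 160179 6052190 4151259 96457) (v5 50961 4144934 4101472 54111 435) (v5 6052611 4096807 99580 6753 128466) (v5 6055111 97194 3704 135396 4128830)) (v5 (v5 12102863 96166 4459 54881 4144822) (v5 53481 1293 114691 14121262 4208845) (v5 5996 176186 16135355 4134498 48441) (v5 51591 4176817 12101836 102009 1080) (v5 4036861 4033686 98960 7368 176336)) (v5 (v5 22184123 4192930 36331 8008 176452) (v5 6053861 96549 5589 136026 6050713) (v5 37231 1550 162699 14152504 4128951) (v5 4731 33181 4149860 12104265 96336) (v5 37236 4112940 12101216 102624 1700)) (v5 (v5 179987 4034296 4100587 103264 1816) (v5 4036226 4224939 100845 6998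 144337) (v5 4037471 96806 3819 151267 4208961) (v5 37221 295 35071 4167640 4224852) (v5 3466 176574 4132714 4039372 96956))) (v5 (v5 (v5 5113 112547 14134345 12105393 97075) (v5 52869 1924 36712 4039875 6050086) (v5 4036731 32547 5340 55389 6050328) (v5 6054740 4033556 35697 7501 49089) (v5 36722 4034191 6053211 56019 1199)) (v5 (v5 100369 911 114437 4118615 6049693) (v5 6052840 97180 3560 134629 4128838) (v5 6052215 4096803 100596 6861 128454) (v5 50979 4144940 4099953 54129 453) (v5 6353 160195 6052586 4152402 96455)) (v5 (v5 12102625 96167 4205 54759 4144825) (v5 4038611 4033672 98816 9146 176344) (v5 53499 4176813 12102852 102117 1068) (v5 4468 176192 16134466 4134636 48459) (v5 51609 1309 114832 14122405 4208843)) (v5 (v5 22183885 4192931 36707 7881 176455) (v5 36727 4112926 12101072 104402 1708) (v5 5733 33177 4147701 12104373 96324) (v5 36732 1556 164605 14152142 4128969) (v5 6054115 96565 4700 134124 6050711)) (v5 (v5 179749 4034297 4100963 103137 1819) (v5 3848 176560 4133095 4039250 96964) (v5 36717 291 35067 4168148 4224840) (v5 4037976 96812 3445 150635 4208979) (v5 4036096 4224955 99956 6616 144335))) (v5 (v5 (v5 6115 97050 12102218 14137774 112571) (v5 4038122 6050303 52214 7499 32576) (v5 35726 1174 52844 6056640 4034200) (v5 53989 6050061 4036700 38876 1963) (v5 6053478 49064 4326 40391 4033575)) (v5 (v5 101371 6049668 4115440 117611 935) (v5 6052843 128429 3686 102755 4096832) (v5 3585 96430 4149227 6055365 160204) (v5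 6052233 4128813 131454 6879 97219) (v5 53979 428 50954 4104647 4144959)) (v5 (v5 12103627 4144800 51584 7634 96191) (v5 53984 1043 98942 12105011 4176842) (v5 53999 4208818 14119230 117866 1318) (v5 4036847 176319 5971 102135 4033711) (v5 4230 48434 4131461 16138530 176211)) (v5 (v5 22184887 176430 4706 39506 4192955) (v5 4850 96299 12101198 4153035 33206) (v5 6054113 6050686 130949 8764 96574) (v5 36356 1683 101227 12104391 4112965) (v5 36986 4128944 14148967 165874 1575)) (v5 (v5 180751 1794 99962 4103762 4034321) (v5 35096 4224815 4164973 38246 320) (v5 4037472 144310 3441 104020 4224964) (v5 5470 96939 4036075 4135889 176599) (v5 4036222 4208954 147460 6994 96831)))

table02 : Trie 4
table02 = v5 (v5 (v5 (v5 896 112922 14166349 14169524 112947) (v5 5493 49171 6053843 4040001 32826) (v5 4100 32796 4038096 6057018 49196) (v5 6364 32801 4036826 6056383 49211) (v5 4971 49186 6053208 4041271 32821)) (v5 (v5 260 32786 4131062 4134237 32811) (v5 4213 112927 4036191 4134877 144210) (v5 3460 144180 4132972 4039366 112952) (v5 3854 144185 4131702 4039256 112967) (v5 6226 112942 4036081 4136147 144205)) (v5 (v5 1144 144170 6052838 6056013 144195) (v5 6108 32791 4131067 14168889 208344) (v5 5995 208314 14166984 4134242 32816) (v5 4469 208319 14165714 4134257 32831) (v5 4356 32806 4131082 14170159 208339)) (v5 (v5 1653 208304 4037461 4040636 208329) (v5 4853 144175 14165079 4136777 49206) (v5 5355 49176 4131697 14168254 144200) (v5 5109 49181 4133602 14168144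 144215) (v5 5611 144190 14164969 4134872 49201)) (v5 (v5 390 49166 4132337 4135512 49191) (v5 3598 208309 4132967 6055378 112962) (v5 4715 112932 6052573 4136142 208334) (v5 5724 112937 6052203 4135507 208349) (v5 3716 208324 4132332 6055748 112957))) (v5 (v5 (v5 4989 128421 14118722 12105517 96822) (v5 36992 1796 52336 6056381 4033707) (v5 6053233 48421 5468 39512 4034201) (v5 4038615 6050058 51571 7250 33212) (v5 52346 6050693 4036832 40142 946)) (v5 (v5 100245 1035 130311 4134365 4033566) (v5 4036715 97052 3813 118252 4112961) (v5 4036090 4128931 100724 6610 160205) (v5 35102 4128810 4131958 38252 326) (v5 6229 144317 4036207 4104398 96202)) (v5 (v5 12102501 96291 4458 38882 4144950) (v5 6055113 6049670 99069 9145 176595) (v5 37622 4208941 12102980 101866 1319) (v5 4344 176316 14149964 4102508 32582) (v5 35732 1181 130456 16138911 4192966)) (v5 (v5 22183761 4224807 52331 8005 176202) (v5 52351 4144802 12101325 104401 1959) (v5 5609 49051 4116202 12104122 96575) (v5 52356 1680 148727 14136390 4096838) (v5 4037990 96437 4828 165875 4034332)) (v5 (v5 179625 6050295 4148719 103261 1566) (v5 3724 176432 4165100 6055756 97215) (v5 52341 415 50941 4152146 4224965) (v5 6054478 96936 3573 118882 4176848) (v5 6052598 4208825 100084 6740 112582))) (v5 (v5 (v5 4096 96796 12102596 14121897 128446) (v5 4038121 33171 4964 54746 6050083) (v5 35976 4033676 6054095 55511 1821) (v5 53486 925 35946 4040007 6050718) (v5 6053856 4034190 35951 8643 48446)) (v5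 (v5 99352 4033540 4131444 133486 1060) (v5 35961 285 35061 4135133 4128835) (v5 4036216 4112930 116596 6988 97077) (v5 3476 96181 4100202 4039382 144342) (v5 4038731 160194 3829 103899 4128956)) (v5 (v5 12101608 4144924 35956 7633 96316) (v5 5981 32541 4099317 14153139 176341) (v5 6055131 176564 4319 102244 6049695) (v5 35966 4192945 16134085 133631 1206) (v5 35981 1308 99085 12106155 4208966)) (v5 (v5 22182868 176176 5084 55506 4224832) (v5 52226 4096797 14133329 151902 1705) (v5 52856 1928 99575 12104500 4144827) (v5 4037486 4034311 164604 8003 96462) (v5 5361 96564 12101341 4119377 49076)) (v5 (v5 178732 1540 100340 4151894 6050320) (v5 6052606 4176807 116341 6748 96961) (v5 4716 97184 6052195 4168275 176457) (v5 6054481 112561 3699 103259 4208850) (v5 50966 4224954 4148590 54116 440))) (v5 (v5 (v5 6368 96797 12102342 14121770 128449) (v5 6054120 4034176 36337 7246 48454) (v5 51604 921 36967 4040515 6050706) (v5 37987 4033682 6053206 54754 1839) (v5 4037351 33187 4075 56519 6050081)) (v5 (v5 101624 4033541 4131190 133489 1063) (v5 4036716 160180 3435 102502 4128964) (v5 3838 96177 4101223 4039240 144330) (v5 4036106 4112936 115077 6626 97095) (v5 37977 301 35077 4136276 4128833)) (v5 (v5 12103880 4144925 35707 7506 96319) (v5 37982 1294 98691 12104758 4208974) (v5 37997 4192941 16135736 133994 1194) (v5 6052845 176570 5970 101882 6049713) (v5 4483 32557 4099333 14154282 176339)) (v5 (v5 22185140 176177 4830 55384 4224835) (v5 5103 96550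 12100947 4121155 49084) (v5 4037986 4034307 162700 8511 96450) (v5 52234 1934 101226 12104138 4144845) (v5 52864 4096813 14133215 150000 1703)) (v5 (v5 181004 1541 100086 4151767 6050323) (v5 50974 4224940 4148971 54124 448) (v5 6053470 112557 3565 103767 4208838) (v5 5723 97190 6052581 4167513 176475) (v5 6052220 4176823 115707 6866 96959))) (v5 (v5 (v5 5475 128424 14118595 12105771 96821) (v5 53369 6050681 4037340 39121 950) (v5 4036857 6050056 53344 8139 33196) (v5 6054743 48429 4071 39126 4034215) (v5 36346 1814 51579 6057270 4033701)) (v5 (v5 100731 1038 130314 4134619 4033565) (v5 4210 144305 4036065 4103377 96206) (v5 35086 4128808 4133101 38236 310) (v5 4036232 4128939 99327 7004 160219) (v5 4038732 97070 3451 119771 4112955)) (v5 (v5 12102987 96294 4331 39131 4144949) (v5 37606 1169 130819 16137260 4192970) (v5 6120 176314 14151107 4102492 32566) (v5 35716 4208949 12101583 102260 1333) (v5 6052863 6049688 98707 7494 176589)) (v5 (v5 22184247 4224810 52209 8259 176201) (v5 4037482 96425 5336 167779 4034336) (v5 53359 1678 146825 14136504 4096822) (v5 4855 49059 4117980 12104516 96589) (v5 53364 4144820 12100963 102750 1953)) (v5 (v5 180111 6050298 4148592 103515 1565) (v5 6052228 4208813 100592 6874 112586) (v5 6053473 96934 3691 119516 4176832) (v5 53349 423 50949 4151765 4224979) (v5 3590 176450 4164338 6055370 97209)))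

table03 : Trie 4
table03 = v5 (v5 (v5 (v5 1273 160424 14134217 14137392 160449) (v5 5616 49549 6053468 4039876 32952) (v5 4479 32922 4037971 6056643 49574) (v5 5985 32927 4036701 6056008 49589) (v5 4848 49564 6052833 4041146 32947)) (v5 (v5 261 32912 4146938 4150113 32937) (v5 4336 160429 4036066 4119381 112206) (v5 3839 112176 4117476 4039241 160454) (v5 3475 112181 4116206 4039381 160469) (v5 6103 160444 4036206 4120651 112201)) (v5 (v5 890 112166 6053213 6056388 112191) (v5 6231 32917 4115571 14136757 192342) (v5 6374 192312 14134852 4118746 32942) (v5 4090 192317 14133582 4118636 32957) (v5 4233 32932 4115461 14138027 192337)) (v5 (v5 1526 192302 4037336 4040511 192327) (v5 4976 112171 14132947 4152653 49584) (v5 5734 49554 4147573 14136122 112196) (v5 4730 49559 4149478 14136137 112211) (v5 5488 112186 14132962 4150748 49579)) (v5 (v5 393 49544 4116841 4120016 49569) (v5 3721 192307 4148843 6055753 160464) (v5 5094 160434 6052198 4152018 192332) (v5 5345 160439 6052578 4151383 192347) (v5 3593 192322 4148208 6055373 160459))) (v5 (v5 (v5 5604 144297 14150599 12105392 97200) (v5 52991 6050300 4037467 39247 1329) (v5 4036730 6049675 52966 8010 33197) (v5 6055118 48426 4448 39252 4034342) (v5 36347 1685 51576 6057651 4033576)) (v5 (v5 100860 1161 146187 4150241 4033692) (v5 4339 128426 4036192 4103503 96585) (v5 35087 4144807 4149354 38237 311) (v5 4036105 4128936 99704 6625 112592) (v5 4038605 96941 3828 119522 4144960)) (v5 (v5 12103116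 96417 4208 39257 4112946) (v5 37607 1040 130316 14136885 4224975) (v5 6249 176437 14119357 4102493 32567) (v5 35717 4208946 12101960 101881 956) (v5 6053238 6050063 99084 7240 176212)) (v5 (v5 22184376 4208805 52206 7880 176580) (v5 4037355 96296 5463 120152 4034211) (v5 52981 1801 130946 16137006 4096823) (v5 4984 49056 4165735 12104137 96212) (v5 52986 4128815 12101340 102496 1576)) (v5 (v5 180240 6050673 4132593 103136 1944) (v5 6052603 4224812 100719 6745 160215) (v5 6053848 97057 3568 167145 4176833) (v5 52971 420 50946 4135635 4192976) (v5 3719 176321 4116837 6055751 96832))) (v5 (v5 (v5 5991 97174 12102471 14153774 144322) (v5 6054501 4034301 36336 7623 48451) (v5 51601 1298 36966 4040642 6050325) (v5 37861 4033555 6052825 54751 1710) (v5 4037476 33186 4454 56141 6049700)) (v5 (v5 101247 4033666 4147320 149362 1186) (v5 4036841 112551 3814 102879 4128961) (v5 3461 96554 4101222 4039367 128451) (v5 4036231 4144939 115326 7003 96966) (v5 37851 300 35076 4152529 4144832)) (v5 (v5 12103503 4112920 35706 7383 96442) (v5 37856 915 99070 12105135 4208971) (v5 37871 4224944 14135234 133491 1065) (v5 6053226 176191 6224 102259 6050088) (v5 4106 32556 4099332 14122532 176462)) (v5 (v5 22184763 176554 4959 55381 4208830) (v5 4726 96171 12101326 4168910 49081) (v5 4038111 4034180 115071 8638 96321) (v5 52231 1555 101480 12104515 4128840) (v5 52861 4096812 16133465 134121 1826)) (v5 (v5 180627 1918 100215 4135768 6050698) (v5 50971 4192935 4133349 54121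 445) (v5 6053851 160184 3694 103894 4224837) (v5 5346 96811 6052200 4120012 176346) (v5 6052601 4176822 163334 6743 97082))) (v5 (v5 (v5 4473 97175 12102217 14153647 144325) (v5 4037996 33172 4835 54749 6049708) (v5 36102 4033551 6054476 55889 1698) (v5 53489 1304 36072 4039880 6050343) (v5 6053475 4034317 36077 8766 48449)) (v5 (v5 99729 4033667 4147066 149365 1189) (v5 36087 286 35062 4151132 4144840) (v5 4036091 4144935 116347 6611 96954) (v5 3853 96560 4100328 4039255 128469) (v5 4038606 112567 3450 104022 4128959)) (v5 (v5 12101985 4112921 36082 7256 96445) (v5 6358 32542 4099318 14121135 176470) (v5 6054750 176187 4065 101867 6050076) (v5 36092 4224950 14133710 133509 1083) (v5 36107 931 98706 12106278 4208969)) (v5 (v5 22183245 176555 4705 55884 4208833) (v5 52229 4096798 16133831 136029 1834) (v5 52859 1551 99321 12104123 4128828) (v5 4037361 4034186 116977 7876 96339) (v5 5738 96187 12100962 4166878 49079)) (v5 (v5 179109 1919 99961 4135641 6050701) (v5 6052225 4176808 163970 6871 97090) (v5 5093 96807 6052576 4120520 176334) (v5 6054100 160190 3570 103132 4224855) (v5 50969 4192951 4132460 54119 443))) (v5 (v5 (v5 4860 144300 14150472 12105646 97199) (v5 36991 1673 52714 6056000 4033580) (v5 6052858 48424 5591 39511 4034326) (v5 4038742 6049683 51574 7629 33211) (v5 52724 6050318 4036705 40141 1323)) (v5 (v5 100116 1164 146190 4150495 4033691) (v5 4036842 96929 3436 118501 4144964) (v5 4036217 4128934 100847 6989 112576) (v5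 35101 4144815 4147957 38251 325) (v5 6100 128444 4036080 4104397 96579)) (v5 (v5 12102372 96420 4081 38881 4112945) (v5 6054738 6050051 98692 9399 176216) (v5 37621 4208944 12103103 102245 940) (v5 4215 176445 14117960 4102507 32581) (v5 35731 1058 130334 14138409 4224969)) (v5 (v5 22183632 4208808 52709 8134 176579) (v5 52729 4128803 12100948 104655 1580) (v5 5480 49054 4163703 12104501 96196) (v5 52734 1809 132854 16136640 4096837) (v5 4038117 96314 4701 118246 4034205)) (v5 (v5 179496 6050676 4132466 103390 1943) (v5 3595 176309 4117345 6055375 96836) (v5 52719 418 50944 4136524 4192960) (v5 6054103 97065 3696 166509 4176847) (v5 6052223 4224830 99957 6869 160209)))

table04 : Trie 4
table04 = v5 (v5 (v5 (v5 1020 128546 14118721 14121896 128571) (v5 5744 33421 4037466 6056003 48954) (v5 4228 48924 6054098 4040641 33446) (v5 6236 48929 6052828 4040006 33461) (v5 4720 33436 4036831 6057273 48949)) (v5 (v5 388 48914 4163069 4166244 48939) (v5 4464 128551 6052193 4119256 112332) (v5 3588 112302 4117351 6055368 128576) (v5 3726 112307 4116081 6055758 128591) (v5 5975 128566 6052583 4120526 112327)) (v5 (v5 891 112292 4036711 4039886 112317) (v5 6359 48919 4115446 14121261 224220) (v5 6123 224190 14119356 4118621 48944) (v5 4341 224195 14118086 4118761 48959) (v5 4105 48934 4115586 14122531 224215)) (v5 (v5 1779 224180 6053463 6056638 224205) (v5 5104 112297 14117451 4168784 33456) (v5 5483 33426 4163704 14120626 112322) (v5 4981 33431 4165609 14120516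 112337) (v5 5360 112312 14117341 4166879 33451)) (v5 (v5 265 33416 4116716 4119891 33441) (v5 3849 224185 4164974 4039251 128586) (v5 4843 128556 4036196 4168149 224210) (v5 5596 128561 4036076 4167514 224225) (v5 3465 224200 4164339 4039371 128581))) (v5 (v5 (v5 6244 96921 12102595 16138276 160200) (v5 4037995 6050678 52211 7370 32577) (v5 35727 1045 52841 6057021 4034327) (v5 53611 6049680 4036827 38877 1586) (v5 6053853 49061 4203 40517 4033702)) (v5 (v5 101500 6050043 4163195 165240 1314) (v5 6053218 144302 3563 102626 4096833) (v5 3714 96301 4133228 6055746 112577) (v5 6052608 4144812 130951 6750 96842) (v5 53601 425 50951 4104773 4112956)) (v5 (v5 12103756 4128795 51581 7255 96570) (v5 53606 1166 98819 12104882 4176843) (v5 53621 4224817 14151234 117617 941) (v5 4036720 176442 6098 102006 4033586) (v5 4359 48431 4147214 14138155 176590)) (v5 (v5 22185016 176301 5083 39507 4224960) (v5 4979 96422 12101075 4136905 33207) (v5 6054488 6050305 146822 8510 96197) (v5 36357 1806 101354 12104262 4144970) (v5 36987 4128941 14117467 118247 1954)) (v5 (v5 180880 1665 100339 4103763 4034196) (v5 35097 4208810 4117472 38247 321) (v5 4037345 128431 3818 103766 4192961) (v5 5599 97062 4036202 4151511 176222) (v5 4036095 4208951 131581 6615 97210))) (v5 (v5 (v5 4736 160174 16134720 12105770 96946) (v5 52866 1545 36586 4040002 6049705) (v5 4036856 32546 5719 55386 6050703) (v5 6055121 4033681 35696 7378 49086) (v5 36596 4034316 6052830 56016 1070)) (v5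 (v5 99992 1288 162064 4166370 6050068) (v5 6053221 96801 3689 134126 4144837) (v5 6052596 4096802 100975 6738 144327) (v5 50976 4112935 4099952 54126 450) (v5 5976 112566 6052205 4136403 96326)) (v5 (v5 12102248 96544 4334 54756 4128820) (v5 4038736 4033545 98945 9273 176467) (v5 53496 4176812 12103231 101994 1191) (v5 4091 176569 14133964 4150389 48456) (v5 51606 930 114456 14154409 4224842)) (v5 (v5 22183508 4224934 36581 8258 176326) (v5 36601 4144929 12101201 104529 1831) (v5 5356 33176 4132079 12104250 96447) (v5 36606 1933 116976 14120642 4128966) (v5 6054496 96186 4954 149997 6050330)) (v5 (v5 179372 4034170 4100837 103514 1690) (v5 3471 176181 4149225 4039377 97087) (v5 36591 290 35066 4120647 4208835) (v5 4038101 97189 3824 134756 4208976) (v5 4036221 4192950 100210 6993 128456))) (v5 (v5 (v5 5728 160175 16135101 12105643 96949) (v5 37367 4034302 6053846 55249 1078) (v5 6052855 4033677 37342 7886 49074) (v5 4038616 32552 4195 55254 6050721) (v5 52224 1561 35702 4041145 6049703)) (v5 (v5 100984 1289 162065 4166243 6050071) (v5 4463 112552 6052571 4135006 96334) (v5 50964 4112931 4101598 54114 438) (v5 6052230 4096808 99451 6876 144345) (v5 6054730 96817 3575 135899 4144835)) (v5 (v5 12103240 96545 4080 55259 4128823) (v5 53484 916 114442 14153012 4224850) (v5 6373 176565 14134980 4150497 48444) (v5 51594 4176818 12101707 102132 1209) (v5 4036736 4033561 98831 7241 176465)) (v5 (v5 22184500 4224935 36332 8131 176329) (v5 6053480 96172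 5335 151905 6050338) (v5 37357 1929 115072 14120500 4128954) (v5 5108 33182 4133730 12104388 96465) (v5 37362 4144945 12101087 102497 1829)) (v5 (v5 180364 4034171 4100588 103387 1693) (v5 4036101 4192936 100591 6621 128464) (v5 4037346 97185 3440 135394 4208964) (v5 37347 296 35072 4119885 4208853) (v5 3843 176197 4148336 4039245 97085))) (v5 (v5 (v5 4220 96924 12102468 16137895 160199) (v5 6054123 49049 4711 38871 4033706) (v5 52104 6049678 4037970 39761 1570) (v5 37611 1053 52074 6056005 4034341) (v5 4037477 6050696 52079 8894 32571)) (v5 (v5 99476 6050046 4163068 165239 1313) (v5 52089 413 50939 4103127 4112960) (v5 6052218 4144810 132724 6864 96826) (v5 3600 96309 4131831 6055380 112591) (v5 6054733 144320 3701 104150 4096827)) (v5 (v5 12101732 4128798 52084 7509 96569) (v5 6105 48419 4147322 14137139 176594) (v5 4038752 176440 4066 102120 4033570) (v5 52094 4224825 14149837 117631 955) (v5 52109 1184 98957 12106406 4176837)) (v5 (v5 22182992 176304 4956 39756 4224959) (v5 36351 4128929 14117325 120151 1958) (v5 36981 1804 99322 12104376 4144954) (v5 6053488 6050313 148730 8129 96211) (v5 5485 96440 12101213 4135254 33201)) (v5 (v5 178856 1668 100212 4104012 4034195) (v5 4036227 4208939 132219 6999 97214) (v5 4840 97060 4036070 4152400 176206) (v5 4038102 128439 3446 103385 4192975) (v5 35091 4208828 4116710 38241 315)))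

table10 : Trie 4
table10 = v5 (v5 (v5 (v5 2 278 35054 38229 303) (v5 36989 33169 36334 38869 32574) (v5 35724 32544 36964 39509 33194) (v5 37609 32549 35694 38874 33209) (v5 36344 33184 35699 40139 32569)) (v5 (v5 258 32534 4099310 4102485 32559) (v5 35709 283 35059 4103125 4096830) (v5 35084 4096800 4101220 38234 308) (v5 35099 4096805 4099950 38249 323) (v5 37599 298 35074 4104395 4096825)) (v5 (v5 32514 4096790 35704 38879 4096815) (v5 37604 32539 4099315 40769 4176840) (v5 37619 4176810 35689 4102490 32564) (v5 35714 4176815 37594 4102505 32579) (v5 35729 32554 4099330 38864 4176835)) (v5 (v5 33149 4176800 36329 39504 4176825) (v5 36349 4096795 36959 4105025 33204) (v5 36979 33174 4099945 40134 4096820) (v5 36354 33179 4101850 39499 4096835) (v5 36984 4096810 36324 4103120 33199)) (v5 (v5 263 33164 4100585 4103760 33189) (v5 35094 4176805 4101215 38244 318) (v5 36339 288 35064 4104390 4176830) (v5 36969 293 35069 4103755 4176845) (v5 35089 4176820 4100580 38239 313))) (v5 (v5 (v5 3453 27 3303 38357 32058) (v5 37371 33422 36590 38997 32703) (v5 36106 32923 37470 39637 33323) (v5 37991 32802 35950 39127 33716) (v5 36726 33563 36205 40392 33076)) (v5 (v5 98709 783 98559 4102613 4033314) (v5 4036464 128552 3433 118502 4096959) (v5 3458 112177 4101726 4039364 160709) (v5 3473 144186 4100206 4039379 112718) (v5 4038354 144821 3448 135903 4097332)) (v5 (v5 12100965 96039 6053089 55263 112446) (v5 6054862 48920 98689 12120758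 240099) (v5 54000 192313 16135609 165495 6049823) (v5 52095 208320 14133583 117882 6049964) (v5 6052987 48557 98704 12138159 192088)) (v5 (v5 22182225 176049 6053714 55888 192456) (v5 52730 112298 12100945 152409 6050589) (v5 6054237 49555 162953 12167751 112073) (v5 6053612 49182 117230 12120138 160094) (v5 53365 128315 12100960 134628 6050458)) (v5 (v5 178089 1413 116215 4119639 4033944) (v5 3468 224186 4132968 4039374 160341) (v5 4037094 160435 3438 119642 4176959) (v5 4037724 112938 3443 166635 4177352) (v5 3463 192197 4148209 4039369 113086))) (v5 (v5 (v5 3328 32032 35436 6478 52) (v5 37118 33675 36841 39125 32827) (v5 35853 32672 37346 39765 33447) (v5 37738 33055 36201 39380 33588) (v5 36473 33312 36081 40645 32948)) (v5 (v5 98584 4033288 4099692 101734 808) (v5 3958 112677 4036063 4103381 144211) (v5 4036088 4096928 116851 6608 128577) (v5 4036103 4097311 131077 6623 144846) (v5 5848 160698 4036078 4104901 112202)) (v5 (v5 12100840 112420 51707 6056264 96064) (v5 53988 6049923 114821 14136758 208345) (v5 6055003 240068 12119107 101864 48945) (v5 6053098 192067 12133333 101879 48582) (v5 52113 6049812 162464 16138784 192338)) (v5 (v5 22182100 192430 52332 6056889 176074) (v5 6053733 160053 12117077 120405 49207) (v5 53363 6050558 146948 12104120 112323) (v5 52738 6050437 132977 12104135 128340) (v5 6054368 112062 12164720 166128 49580)) (v5 (v5 177964 4033918 4116713 119390 1438) (v5 4036098 4177311 164349 6618 112963) (v5 4588 160310 4036068 4136143 224211) (v5 5218 113065 4036073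 4151384 192222) (v5 4036093 4176948 116086 6613 160460))) (v5 (v5 (v5 3331 32033 35182 6481 55) (v5 37495 33298 36462 39248 32956) (v5 36230 33051 37217 39888 33576) (v5 38115 32678 35822 39003 33465) (v5 36850 33691 35952 40268 32825)) (v5 (v5 98587 4033289 4099438 101737 811) (v5 3961 160684 4036189 4103504 112210) (v5 4036214 4097307 132728 6986 144834) (v5 4036229 4096934 115327 7001 128595) (v5 5851 112693 4036204 4104524 144209)) (v5 (v5 12100843 112421 52088 6056137 96067) (v5 53607 6049798 162320 16137387 192346) (v5 6054878 192063 12134984 102242 48570) (v5 6052973 240074 12117583 102257 48963) (v5 51732 6049939 114707 14138531 208343)) (v5 (v5 22182103 192431 52713 6056762 176077) (v5 6053608 112048 12164576 167906 49588) (v5 52982 6050433 131453 12104498 128328) (v5 52357 6050564 149234 12104513 112341) (v5 6054243 160069 12116963 118373 49205)) (v5 (v5 177967 4033919 4116464 119263 1441) (v5 4036224 4176934 116467 6996 160468) (v5 4591 113061 4036194 4152022 192210) (v5 5221 160316 4036199 4135511 224229) (v5 4036219 4177327 163460 6991 112961))) (v5 (v5 (v5 3831 30 3306 38611 32057) (v5 37242 33551 36713 39376 33080) (v5 35977 32800 37093 40016 33700) (v5 37862 32931 36073 39256 33337) (v5 36597 33440 35828 40521 32697)) (v5 (v5 99087 786 98562 4102867 4033313) (v5 4036463 144809 3811 134252 4097336) (v5 3836 144184 4101349 4039238 112702) (v5 3851 112185 4100329 4039253 160723) (v5 4038353 128570 3826 120026 4096953)) (v5 (v5 12101343 96042 6052962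 54882 112445) (v5 6054989 48545 99067 12136508 192092) (v5 53625 208318 14135356 117996 6049948) (v5 51720 192321 16134212 165639 6049837) (v5 6053114 48938 99082 12122282 240093)) (v5 (v5 22182603 176052 6053587 55507 192455) (v5 52355 128303 12101323 136152 6050462) (v5 6054364 49180 115198 12120252 160078) (v5 6053739 49563 164731 12167895 112087) (v5 52990 112316 12101338 150123 6050583)) (v5 (v5 178467 1416 116088 4119888 4033943) (v5 3846 192185 4148847 4039248 113090) (v5 4037093 112936 3816 167524 4177336) (v5 4037723 160443 3821 119261 4176973) (v5 3841 224204 4132336 4039243 160335)))

table11 : Trie 4
table11 = v5 (v5 (v5 (v5 893 112544 12117965 12121140 112569) (v5 37117 4034299 6053593 55250 948) (v5 36103 918 53345 6056768 4034324) (v5 37865 923 52075 6056133 4034339) (v5 36851 4034314 6052958 56520 943)) (v5 (v5 7 908 114434 117609 933) (v5 35837 112549 51440 118249 96204) (v5 35463 96174 116344 54615 112574) (v5 35355 96179 115074 54255 112589) (v5 38106 112564 51080 119519 96199)) (v5 (v5 763 96164 6053088 6056263 96189) (v5 37732 913 114439 12120505 4192968) (v5 37998 4192938 12118600 117614 938) (v5 35970 4192943 12117330 117629 953) (v5 36236 928 114454 12121775 4192963)) (v5 (v5 33277 4192928 52710 55885 4192953) (v5 36477 96169 12116695 120149 4034334) (v5 37358 4034304 115069 12119870 96194) (v5 36610 4034309 116974 12119885 96209) (v5 37491 96184 12116710 118244 4034329)) (v5 (v5 32018 4034294 115709 118884 4034319) (v5 35222 4192933 116339 6055628 112584) (v5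 36718 112554 6052323 119514 4192958) (v5 37225 112559 6052453 118879 4192973) (v5 35596 4192948 115704 6055498 112579))) (v5 (v5 (v5 4093 144801 14134218 12169021 160326) (v5 53370 1418 36840 4039624 6049833) (v5 4098 48925 6054349 4040639 33701) (v5 4038364 32928 4068 55258 6050468) (v5 6053602 49187 4073 40267 4033324)) (v5 (v5 99349 48537 114690 117737 32688) (v5 4083 32 3308 118377 112083) (v5 51465 112303 116850 38487 112703) (v5 35481 112182 99324 54633 113096) (v5 53980 112943 35330 119772 112456)) (v5 (v5 12101605 128295 4078 39132 4096944) (v5 37986 788 98564 12120633 4176969) (v5 6054877 224191 3938 133998 6049949) (v5 4088 192318 12101580 4118759 33086) (v5 4103 32807 4099586 12122028 192466)) (v5 (v5 22182865 192177 36585 4040634 240084) (v5 4037104 96044 12100820 167905 33333) (v5 4037734 33427 99194 12136254 160079) (v5 52735 49560 4133603 39627 4097342) (v5 37366 144191 16133719 150504 4033954)) (v5 (v5 178729 33543 4100841 166765 6050574) (v5 6052352 176054 4148844 38372 160719) (v5 36721 128557 6052449 135898 4177337) (v5 6054227 160440 35575 4103883 192098) (v5 4035844 208325 163588 4038994 32068))) (v5 (v5 (v5 5223 160300 12166100 14137393 144826) (v5 4037993 6050427 52337 7243 32953) (v5 52108 6049802 4037968 40015 1443) (v5 6054993 4033303 36076 7248 49212) (v5 4593 33690 4036453 6057524 48950)) (v5 (v5 100479 32662 114816 117865 48562) (v5 35838 113055 51062 102499 112207) (v5 3333 112052 116726 6483 57) (v5 51483 112435 115581 38505 112968) (v5 53983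 112692 35456 120025 112328)) (v5 (v5 12102735 4096918 36211 7253 128320) (v5 5853 33045 4115443 12104755 192343) (v5 37748 4176938 12118982 101739 813) (v5 3963 192445 12117837 4102761 32832) (v5 6053113 6049938 130457 7113 224216)) (v5 (v5 22183995 240058 4037083 39760 192202) (v5 52733 4097301 37341 4136778 49585) (v5 4037983 33302 163079 12103995 96069) (v5 36483 4033933 148853 16136894 144216) (v5 4037988 160068 12132713 102369 33452)) (v5 (v5 179859 6050548 163844 4104016 33568) (v5 6052478 192057 4101597 38750 160465) (v5 6053723 160688 35571 4152019 176079) (v5 4037973 32047 4035823 166763 208350) (v5 35218 4177326 131707 6055624 128582))) (v5 (v5 (v5 4611 160301 12165846 14137896 144829) (v5 5241 33676 4037464 6056127 48958) (v5 6052983 4033299 37092 7761 49200) (v5 53612 6049808 4036449 39253 1461) (v5 4037474 6050443 52083 8391 32951)) (v5 (v5 99867 32663 114562 117738 48565) (v5 51712 112678 35312 118628 112336) (v5 51087 112431 116597 38613 112956) (v5 3351 112058 115202 6501 75) (v5 38105 113071 51458 103647 112205)) (v5 (v5 12102123 4096919 35957 7131 128323) (v5 6054863 6049924 130823 9021 224224) (v5 5871 192441 12118853 4102869 32820) (v5 36220 4176944 12117458 101757 831) (v5 3981 33061 4115584 12105903 192341)) (v5 (v5 22183383 240059 4037459 39633 192205) (v5 4037479 160054 12133079 104277 33460) (v5 37485 4033929 147329 16136752 144204) (v5 4037484 33308 164730 12104013 96087) (v5 52987 4097317 36452 4134876 49583)) (v5 (v5 179247 6050549 163590 4103889 33571)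 (v5 35600 4177312 132723 6055502 128590) (v5 4037469 32043 4035819 167271 208338) (v5 6054228 160694 35197 4151387 176097) (v5 6052348 192073 4100708 38368 160463))) (v5 (v5 (v5 6366 144804 14134721 12169275 160325) (v5 6054374 49175 4586 39251 4033328) (v5 4036478 32926 5216 55512 6050452) (v5 6361 48933 6052952 4039628 33715) (v5 52350 1436 36078 4041143 6049827)) (v5 (v5 101622 48540 114563 117991 32687) (v5 51715 112931 35438 118756 112460) (v5 35337 112180 100472 54237 113080) (v5 51105 112311 115453 38631 112717) (v5 6351 50 3326 119901 112077)) (v5 (v5 12103878 128298 3956 39386 4096943) (v5 6356 32795 4099694 12121012 192470) (v5 6371 192316 12102728 4118618 33070) (v5 6053099 224199 5846 133632 6049963) (v5 35982 806 98582 12122157 4176963)) (v5 (v5 22185138 192180 36458 4040258 240083) (v5 36602 144179 16133577 152028 4033958) (v5 52985 49558 4131701 40516 4097326) (v5 4037108 33435 101102 12135888 160093) (v5 4037738 96062 12100838 166254 33327)) (v5 (v5 181002 33546 4100714 167019 6050573) (v5 4035848 208313 164096 4038998 32072) (v5 6053724 160438 35193 4104772 192082) (v5 37222 128565 6052327 134882 4177351) (v5 6052474 176072 4148212 38746 160713)))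

table12 : Trie 4
table12 = v5 (v5 (v5 (v5 768 96794 12149847 12153022 96819) (v5 37245 1543 52715 6056253 4033578) (v5 35852 4033548 6054348 55890 1568) (v5 38116 4033553 6053078 55255 1583) (v5 36723 1558 52080 6057523 4033573)) (v5 (v5 32012 4033538 130440 133615 4033563) (v5 35965 96799 6052443 150131 4144962) (v5 35212 4144932 148226 6055618 96824) (v5 35606 4144937 146956 6055508 96839) (v5 37978 96814 6052333 151401 4144957)) (v5 (v5 32896 4144922 51710 54885 4144947) (v5 37860 4033543 146321 12152387 176214) (v5 37747 176184 12150482 149496 4033568) (v5 36221 176189 12149212 149886 4033583) (v5 36108 4033558 146711 12153657 176209)) (v5 (v5 1398 176174 6053713 6056888 176199) (v5 36605 4144927 12148577 136155 1578) (v5 37107 1548 131075 12151752 4144952) (v5 36861 1553 132980 12152142 4144967) (v5 37363 4144942 12148967 134250 1573)) (v5 (v5 12 1538 147591 150766 1563) (v5 35350 176179 132345 54250 96834) (v5 36467 96804 51445 135520 176204) (v5 37476 96809 51075 134885 176219) (v5 35468 176194 131710 54620 96829))) (v5 (v5 (v5 4733 112923 12102215 12137524 160704) (v5 4037744 33548 4708 55253 6049959) (v5 52105 793 37220 4040264 6050453) (v5 6054867 48930 3943 39002 4033964) (v5 4718 49565 6053084 4040894 32698)) (v5 (v5 99989 32787 4131063 133993 6049818) (v5 6052967 144806 35565 4119004 160089) (v5 6052342 96049 4101476 38362 113081) (v5 4035854 112308 99199 4039004 32078) (v5 37981 160445 6052459 119647 4096954)) (v5 (v5 12102245 144171 36210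 4039634 112068) (v5 53985 48542 4099821 40897 4177347) (v5 4038374 176059 14134853 117867 33071) (v5 36096 224196 12101455 165385 4033334) (v5 4036484 32933 114710 12121903 240094)) (v5 (v5 22183505 208305 4703 39757 4176954) (v5 4723 128300 16133704 4105153 33711) (v5 37361 1423 115325 12120123 4097327) (v5 4728 33432 4149479 12167641 112466) (v5 6054242 112187 4573 166000 6050584)) (v5 (v5 179369 49167 99959 135268 33318) (v5 35476 192182 164223 54628 112713) (v5 4713 37 3313 151774 192083) (v5 53350 128562 35325 119007 192476) (v5 51470 192323 99829 38492 160336))) (v5 (v5 (v5 3968 160678 12133968 12105390 112948) (v5 6054373 4033923 36716 7118 48955) (v5 4036728 6049928 52967 7883 33573) (v5 5858 32677 4036698 6056259 49590) (v5 52728 6050442 4036703 40395 818)) (v5 (v5 99224 6049792 130437 4134238 32812) (v5 4036713 32037 4035813 102374 112333) (v5 6052468 160058 4117348 38740 144831) (v5 35228 4096933 115456 6055634 160470) (v5 6054983 113070 35581 4104651 96074)) (v5 (v5 12101480 112042 4036708 39385 144196) (v5 37733 4033293 162574 12104630 224221) (v5 54003 4177316 36071 4102996 48567) (v5 4036718 240073 12117712 117885 32958) (v5 4036733 33060 114836 14138028 176084)) (v5 (v5 22182740 4176928 36836 7878 208330) (v5 4598 112425 12164830 4152654 33457) (v5 5228 33680 4100327 16136879 128325) (v5 6053738 6050563 164984 7748 112212) (v5 37113 4097316 12117092 118500 1448)) (v5 (v5 178604 33292 131712 103134 49192) (v5 51478 192435 116721 38500 128587) (v5 36468 112682 51067 167398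 192207) (v5 53353 160315 35451 103004 192348) (v5 3338 192072 147583 6488 62))) (v5 (v5 (v5 5866 160679 12134349 12105268 112951) (v5 52992 6050428 4037089 38998 826) (v5 3976 32673 4037719 6056767 49578) (v5 4038739 6049934 52078 7126 33591) (v5 6053603 4033939 35827 8891 48953)) (v5 (v5 101122 6049793 130818 4134241 32815) (v5 6052968 113056 35187 4103254 96082) (v5 35590 4096929 116472 6055492 160458) (v5 6052358 160064 4115829 38378 144849) (v5 4038729 32053 4035829 104147 112331)) (v5 (v5 12103378 112043 4036459 39258 144199) (v5 4038734 33046 114692 14137261 176092) (v5 4038749 240069 12118728 117993 32946) (v5 51717 4177322 37722 4102634 48585) (v5 36235 4033309 162210 12106403 224219)) (v5 (v5 22184638 4176929 36582 7756 208333) (v5 36855 4097302 12116948 120278 1456) (v5 6054238 6050559 162825 8386 112200) (v5 4606 33686 4101978 16136767 128343) (v5 5236 112441 12164466 4150752 33455)) (v5 (v5 180502 33293 132093 103012 49195) (v5 3346 192058 148599 6496 70) (v5 52342 160311 35317 103642 192336) (v5 37475 112688 51453 166636 192225) (v5 51092 192451 115832 38618 128585))) (v5 (v5 (v5 5726 112926 12102093 12137143 160703) (v5 5741 49553 6053592 4039873 32702) (v5 6053109 48928 5716 39891 4033948) (v5 53615 801 35823 4039878 6050467) (v5 4037098 33566 3951 56142 6049953)) (v5 (v5 100982 32790 4131066 133612 6049817) (v5 35962 160433 6052317 118631 4096958) (v5 4035838 112306 100972 4038988 32062) (v5 6052484 96057 4100079 38756 113095) (v5 6054984 144824 35203 4120523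 160083)) (v5 (v5 12103238 144174 36083 4039883 112067) (v5 4038358 32921 114818 12120887 240098) (v5 37872 224194 12103228 165749 4033318) (v5 4036468 176067 14134086 118011 33085) (v5 51735 48560 4099459 39246 4177341)) (v5 (v5 22184498 208308 4581 40011 4176953) (v5 6053734 112175 5211 168159 6050588) (v5 5731 33430 4147577 12168005 112450) (v5 36607 1431 117103 12120267 4097341) (v5 5736 128318 16133592 4103502 33705)) (v5 (v5 180362 49170 99837 134887 33317) (v5 51100 192311 100467 38626 160340) (v5 52345 128560 35443 119896 192460) (v5 5721 45 3321 150758 192097) (v5 35342 192200 163461 54242 112707)))

table13 : Trie 4
table13 = v5 (v5 (v5 (v5 771 97172 12134346 12137521 97197) (v5 37368 1921 52340 6056128 4033704) (v5 36231 4033674 6054223 55515 1946) (v5 37737 4033679 6052953 54880 1961) (v5 36600 1936 51705 6057398 4033699)) (v5 (v5 32013 4033664 146316 149491 4033689) (v5 36088 97177 6052318 134630 4112958) (v5 35591 4112928 132725 6055493 97202) (v5 35227 4112933 131455 6055633 97217) (v5 37855 97192 6052458 135900 4112953)) (v5 (v5 32642 4112918 52085 55260 4112943) (v5 37983 4033669 130820 12136886 176592) (v5 38126 176562 12134981 133995 4033694) (v5 35842 176567 12133711 133635 4033709) (v5 35985 4033684 130460 12138156 176587)) (v5 (v5 1401 176552 6053588 6056763 176577) (v5 36728 4112923 12133076 152031 1956) (v5 37486 1926 146951 12136251 4112948) (v5 36482 1931 148856 12135891 4112963) (v5 37240 4112938 12132716 150126 1951)) (v5 (v5 15 1916 132090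 135265 1941) (v5 35473 176557 148221 54625 97212) (v5 36846 97182 51070 151396 176582) (v5 37097 97187 51450 150761 176597) (v5 35345 176572 147586 54245 97207))) (v5 (v5 (v5 5348 160425 12102090 12121393 112698) (v5 5363 49172 6053719 4039999 33081) (v5 6052982 48547 5338 39762 4033949) (v5 53990 798 36200 4040004 6050594) (v5 4037099 33437 3948 56523 6049828)) (v5 (v5 100604 32913 4146939 149869 6049944) (v5 36091 112928 6052444 166130 4097337) (v5 4035839 128305 100594 4038989 32063) (v5 6052357 96054 4100456 38377 160346) (v5 6054857 128567 35580 4120274 112078)) (v5 (v5 12102860 112167 35960 4040009 160074) (v5 4038359 32792 114945 12168386 192093) (v5 38001 192187 12102850 117742 4033319) (v5 4036469 176064 16134339 134013 32708) (v5 52110 48935 4099836 38992 4176964)) (v5 (v5 22184120 192303 4578 39632 4177332) (v5 6053607 144176 5208 120277 6050463) (v5 5353 33553 4131698 12119998 112451) (v5 36736 1428 164858 12136269 4096964) (v5 5358 112313 14133088 4103248 33328)) (v5 (v5 179984 49545 99834 119137 33696) (v5 51475 208310 100464 38497 113091) (v5 52720 144811 35320 167270 192461) (v5 5343 42 3318 135263 240104) (v5 35471 224201 115960 54623 160714))) (v5 (v5 (v5 5863 112672 12118472 12105265 160450) (v5 53373 6050553 4037088 39375 823) (v5 3973 33050 4037718 6056894 49197) (v5 4038613 6049807 51697 7123 33462) (v5 6053728 4033938 36206 8513 48572)) (v5 (v5 101119 6049918 146313 4150114 32938) (v5 6053093 160305 35566 4103631 96079) (v5 35213 4097306 164479 6055619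 112953) (v5 6052483 112057 4116078 38755 128592) (v5 4038603 32052 4035828 103769 128330)) (v5 (v5 12103375 160048 4036458 39135 112192) (v5 4038608 32667 130442 16137514 176089) (v5 4038623 192062 12166735 118120 32817) (v5 52098 4176943 37976 4103011 48960) (v5 35858 4033308 114961 12106025 192212)) (v5 (v5 22184635 4177306 36711 7753 192328) (v5 36478 4096923 12132698 168033 1453) (v5 6054363 6050432 115451 8383 144201) (v5 4603 33307 4102232 14136263 112338) (v5 5233 112440 12117217 4134873 33578)) (v5 (v5 180499 33670 116216 103009 49570) (v5 3343 240063 132342 6493 67) (v5 52723 113060 35446 103639 208335) (v5 37098 160693 51072 119135 224226) (v5 51473 192450 163714 38495 144836))) (v5 (v5 (v5 3971 112673 12118218 12105768 160453) (v5 6054248 4033924 36587 7121 48580) (v5 4036854 6049803 53348 8261 33450) (v5 5861 33056 4036824 6056132 49215) (v5 52347 6050569 4036829 40518 821)) (v5 (v5 99227 6049919 146694 4150117 32941) (v5 4036839 32038 4035814 102377 128338) (v5 6052343 112053 4117099 38363 128580) (v5 35605 4097312 162955 6055507 112971) (v5 6054858 160321 35202 4104774 96077)) (v5 (v5 12101483 160049 4036834 39008 112195) (v5 38110 4033294 114567 12104633 192220) (v5 53622 4176939 35817 4102619 48948) (v5 4036844 192068 12165211 117758 32835) (v5 4036859 32683 130838 16138657 176087)) (v5 (v5 22182743 4177307 36457 8256 192331) (v5 4601 112426 12116823 4136781 33586) (v5 5231 33303 4100073 14136626 112326) (v5 6053613 6050438 117102 7751 144219) (v5 37490 4096939 12133094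 166001 1451)) (v5 (v5 178607 33671 115962 103512 49573) (v5 51097 192436 164095 38623 144844) (v5 36845 160689 51448 119643 224214) (v5 52972 113066 35322 103007 208353) (v5 3341 240079 132088 6491 65))) (v5 (v5 (v5 5111 160428 12102593 12121647 112697) (v5 4037743 33425 5086 54872 6049832) (v5 51730 796 37343 4040263 6050578) (v5 6054994 48555 3946 39381 4033963) (v5 5096 49190 6052957 4040893 33075)) (v5 (v5 100367 32916 4146942 149488 6049943) (v5 6053094 128555 35188 4119253 112082) (v5 6052469 96052 4101599 38741 160330) (v5 4035853 128313 99202 4039003 32077) (v5 37852 112946 6052332 167654 4097331)) (v5 (v5 12102623 112170 35833 4039633 160073) (v5 53610 48923 4099444 41151 4176968) (v5 4038373 176062 16135482 133617 32692) (v5 35967 192195 12101458 118136 4033333) (v5 4036483 32810 114583 12169910 192087)) (v5 (v5 22183883 192306 5081 39886 4177331) (v5 5101 112301 14133451 4105407 33332) (v5 37232 1426 162826 12135873 4096948) (v5 5106 33561 4133606 12120392 112465) (v5 6054369 144194 4576 118626 6050457)) (v5 (v5 179747 49548 100337 119391 33695) (v5 35347 224189 116468 54247 160718) (v5 5091 40 3316 135517 240088) (v5 52975 144819 35448 166889 192475) (v5 51095 208328 99832 38621 113085)))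

table14 : Trie 4
table14 = v5 (v5 (v5 (v5 1271 160172 12150222 12153397 160197) (v5 37496 4034173 6053718 54875 1326) (v5 35980 1296 52970 6056893 4034198) (v5 37988 1301 51700 6056258 4034213) (v5 36472 4034188 6053083 56145 1321)) (v5 (v5 10 1286 162062 165237 1311) (v5 36216 160177 51065 150506 96582) (v5 35340 96552 148601 54240 160202) (v5 35478 96557 147331 54630 160217) (v5 37727 160192 51455 151776 96577)) (v5 (v5 766 96542 6052963 6056138 96567) (v5 38111 1291 146696 12152762 4224972) (v5 37875 4224942 12150857 149871 1316) (v5 36093 4224947 12149587 149511 1331) (v5 35857 1306 146336 12154032 4224967)) (v5 (v5 33531 4224932 52335 55510 4224957) (v5 36856 96547 12148952 167777 4034208) (v5 37235 4034178 162697 12152127 96572) (v5 36733 4034183 164602 12151767 96587) (v5 37112 96562 12148592 165872 4034203)) (v5 (v5 32017 4034168 147966 151141 4034193) (v5 35601 4224937 163967 6055503 160212) (v5 36595 160182 6052448 167142 4224962) (v5 37348 160187 6052328 166507 4224977) (v5 35217 4224952 163332 6055623 160207))) (v5 (v5 (v5 5988 128547 16134974 12121268 113076) (v5 6054247 49550 4583 39122 4033329) (v5 4036479 32797 5213 55893 6050579) (v5 5983 48552 6053079 4039629 33338) (v5 52725 1433 35955 4041269 6049954)) (v5 (v5 101244 48915 162318 165365 33066) (v5 52090 160430 35315 134633 112461) (v5 35466 144181 100469 54618 160331) (v5 51480 128310 115580 38502 160724) (v5 5973 47 3323 167400 160084)) (v5 (v5 12103500 112293 3953 39007 4097322) (v5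 5978 32918 4099571 12136889 192471) (v5 5993 208315 12102725 4118369 32693) (v5 6052972 192192 5843 117757 6049838) (v5 36111 803 98579 12169656 4177342)) (v5 (v5 22184760 224181 36835 4040259 192078) (v5 36731 112172 14132948 136533 4033959) (v5 53360 49177 4147574 40262 4096949) (v5 4037109 33558 101099 12120013 112088) (v5 4037739 96059 12100835 118372 33706)) (v5 (v5 180624 33417 4101091 119012 6050448) (v5 4035849 192308 116595 4038999 32073) (v5 6053597 112933 35570 4104518 240089) (v5 37351 144816 6052454 151139 4176974) (v5 6052347 176069 4132333 38367 112708))) (v5 (v5 (v5 4608 113050 12118347 16138149 128572) (v5 5238 33297 4037338 6056254 48577) (v5 6053108 4033298 37471 7758 49575) (v5 53993 6049933 4036448 39130 1458) (v5 4037348 6050568 51702 8388 32822)) (v5 (v5 99864 33040 162444 165493 48940) (v5 52093 160683 35441 118755 128335) (v5 51468 112430 132347 38490 160455) (v5 3348 160063 163209 6498 72) (v5 37728 160320 51077 103644 144206)) (v5 (v5 12102120 4097296 36086 7128 112318) (v5 6054988 6049797 114946 9018 192217) (v5 5868 192440 12134603 4102746 32943) (v5 35843 4177321 12165465 101754 828) (v5 3978 32682 4115208 12105900 208340)) (v5 (v5 22183380 192052 4037333 40010 224206) (v5 4037353 112047 12117202 104274 33583) (v5 37108 4033928 131072 14136123 112197) (v5 4037358 33685 117356 12104010 96084) (v5 53368 4096938 36706 4150749 49202)) (v5 (v5 179244 6050422 116091 4104266 33442) (v5 35223 4176933 148218 6055629 144841) (v5 4037343 32042 4035818 119770 192333)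 (v5 6054353 112687 35576 4135508 176094) (v5 6052473 240078 4100962 38745 112958))) (v5 (v5 (v5 5226 113051 12118093 16138022 128575) (v5 4038119 6050554 52718 7621 32830) (v5 51727 6049929 4038094 39638 1446) (v5 6054868 4033304 35947 7626 49593) (v5 4596 33313 4036454 6057397 48575)) (v5 (v5 100482 33041 162190 165366 48943) (v5 36215 160306 51443 102877 144214) (v5 3336 160059 164225 6486 60) (v5 51102 112436 131458 38628 160473) (v5 53602 160699 35327 119898 128333)) (v5 (v5 12102738 4097297 35832 7631 112321) (v5 5856 32668 4115194 12105133 208348) (v5 38125 4177317 12166481 101742 816) (v5 3966 192446 12133714 4102884 32961) (v5 6052988 6049813 114582 7116 192215)) (v5 (v5 22183998 192053 4037084 39883 224209) (v5 52352 4096924 37087 4152657 49210) (v5 4038109 33681 115197 12103998 96072) (v5 36860 4033934 133358 14136141 112215) (v5 4038114 112063 12116838 102372 33581)) (v5 (v5 179862 6050423 115837 4104139 33445) (v5 6052353 240064 4101343 38373 112966) (v5 6053598 112683 35192 4136146 176082) (v5 4038099 32048 4035824 119008 192351) (v5 35595 4176949 147964 6055497 144839))) (v5 (v5 (v5 4471 128550 16134847 12121522 113075) (v5 52995 1421 36463 4039623 6049958) (v5 4476 48550 6054222 4040513 33322) (v5 4038363 32805 4446 54877 6050593) (v5 6053729 49568 4451 40646 4033323)) (v5 (v5 99727 48918 162191 165619 33065) (v5 4461 35 3311 166384 160088) (v5 51090 128308 116723 38616 160708) (v5 35352 144189 99702 54252 160345) (v5 53605 160448 35453 135522 112455)) (v5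 (v5 12101983 112296 4456 39261 4097321) (v5 37857 791 98567 12168640 4177346) (v5 6055004 192190 3941 118121 6049822) (v5 4466 208323 12101958 4118383 32707) (v5 4481 32936 4099709 12137778 192465)) (v5 (v5 22183243 224184 36708 4040508 192077) (v5 4037103 96047 12100823 120531 33710) (v5 4037733 33556 99197 12120377 112072) (v5 52360 49185 4149482 39881 4096963) (v5 37237 112190 14132966 134247 4033953)) (v5 (v5 179107 33420 4100964 119266 6050447) (v5 6052479 176057 4132971 38751 112712) (v5 36592 144814 6052322 151393 4176958) (v5 6054354 112941 35198 4104137 240103) (v5 4035843 192326 115833 4038993 32067)))

table20 : Trie 4
table20 = v5 (v5 (v5 (v5 254 32030 3432 6607 32055) (v5 4037741 4033921 4037086 4039621 4033326) (v5 4036476 4033296 4037716 4040261 4033946) (v5 4038361 4033301 4036446 4039626 4033961) (v5 4037096 4033936 4036451 4040891 4033321)) (v5 (v5 32010 4033286 98688 101863 4033311) (v5 4036461 32035 4035811 134380 112458) (v5 4035836 112428 132475 4038986 32060) (v5 4035851 112433 131205 4039001 32075) (v5 4038351 32050 4035826 135650 112453)) (v5 (v5 892 112418 4036456 4039631 112443) (v5 4038356 4033291 130570 9147 192468) (v5 4038371 192438 4067 133745 4033316) (v5 4036466 192443 5972 133885 4033331) (v5 4036481 4033306 130710 7242 192463)) (v5 (v5 1527 192428 4037081 4040256 192453) (v5 4037101 112423 5337 104403 4033956) (v5 4037731 4033926 99323 8512 112448) (v5 4037106 4033931 101228 7877 112463) (v5 4037736 112438 4702 102498 4033951)) (v5 (v5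 32015 4033916 131840 135015 4033941) (v5 4035846 192433 100593 4038996 32070) (v5 4037091 32040 4035816 103768 192458) (v5 4037721 32045 4035821 103133 192473) (v5 4035841 192448 99958 4038991 32065))) (v5 (v5 (v5 3832 279 35055 6985 48060) (v5 4038123 4034174 4037342 4039749 4033455) (v5 4036858 4033675 4038222 4040389 4034075) (v5 4038743 4033554 4036702 4039879 4034468) (v5 4037478 4034315 4036957 4041144 4033828)) (v5 (v5 99088 32535 4099311 102241 6049566) (v5 6052716 160178 35185 4119254 144087) (v5 35210 4112929 116345 6055616 144581) (v5 35225 4144938 162828 6055631 128846) (v5 6054606 112565 35200 4136655 128080)) (v5 (v5 12101344 4096791 51961 7635 128196) (v5 53734 1292 130696 14137265 4240851) (v5 6372 176563 12118601 4166247 48695) (v5 4467 176190 12165084 4118634 48836) (v5 51859 929 114455 14170032 4192840)) (v5 (v5 22182604 4176801 52586 8260 208206) (v5 5102 96548 12132952 4153161 49461) (v5 53109 1927 162698 16152752 4112825) (v5 52484 1554 116975 14120389 4160846) (v5 5737 96185 12116711 4135380 49330)) (v5 (v5 178468 33165 4116967 103516 6050196) (v5 35220 4224938 132596 6055626 128715) (v5 6053346 97183 35190 4120394 224087) (v5 6053976 96810 35195 4167387 208100) (v5 35215 4192949 147837 6055621 144712))) (v5 (v5 (v5 3835 48034 3429 38230 304) (v5 4037870 4034427 4037593 4039877 4033579) (v5 4036605 4033424 4038098 4040517 4034199) (v5 4038490 4033807 4036953 4040132 4034340) (v5 4037225 4034064 4036833 4041397 4033700)) (v5 (v5 99091 6049540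 98685 4102486 32560) (v5 35710 128805 6052315 166003 4144963) (v5 6052340 144056 4117603 38360 160203) (v5 6052355 128059 4131829 38375 112590) (v5 37600 144570 6052330 119520 4112954)) (v5 (v5 12101347 128170 4079 55136 4096816) (v5 6360 48795 4115573 12168259 176215) (v5 53875 4240820 14134979 133871 1317) (v5 51970 4192819 14165841 117630 954) (v5 4485 48684 4163216 12121776 176588)) (v5 (v5 22182607 208180 4704 55761 4176826) (v5 52605 4160805 14117578 120150 1579) (v5 5735 49430 4147700 12136127 96573) (v5 5110 49309 4133729 12119886 96210) (v5 53240 4112814 16149466 165873 1952)) (v5 (v5 178471 6050170 99960 4120142 33190) (v5 6052350 208059 4165101 38370 96835) (v5 36340 128684 6052320 135771 4224963) (v5 36970 144691 6052325 151012 4192974) (v5 6052345 224076 4116838 38365 97208))) (v5 (v5 (v5 3454 48035 3810 38233 307) (v5 4038247 4034050 4037214 4040000 4033708) (v5 4036982 4033803 4037969 4040640 4034328) (v5 4038867 4033430 4036574 4039755 4034217) (v5 4037602 4034443 4036704 4041020 4033577)) (v5 (v5 98710 6049541 99066 4102489 32563) (v5 35713 144556 6052441 118753 4112962) (v5 6052466 128055 4133480 38738 112578) (v5 6052481 144062 4116079 38753 160221) (v5 37603 128821 6052456 167151 4144961)) (v5 (v5 12100966 128171 4460 55009 4096819) (v5 5979 48670 4163072 12121009 176596) (v5 53750 4192815 14166857 117618 942) (v5 51845 4240826 14134090 133759 1335) (v5 4104 48811 4115459 12169407 176213)) (v5 (v5 22182226 208181 5085 55634 4176829) (v5 52480 4112800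 16149577 167781 1960) (v5 5354 49305 4132205 12119874 96198) (v5 4729 49436 4149986 12136015 96591) (v5 53115 4160821 14117214 118248 1577)) (v5 (v5 178090 6050171 100341 4120015 33193) (v5 6052476 224062 4117219 38748 97216) (v5 36343 144687 6052446 151520 4192962) (v5 36973 128690 6052451 135009 4224981) (v5 6052471 208075 4164212 38743 96833))) (v5 (v5 (v5 3457 282 35058 6604 48059) (v5 4037994 4034303 4037465 4040128 4033832) (v5 4036729 4033552 4037845 4040768 4034452) (v5 4038614 4033683 4036825 4040008 4034089) (v5 4037349 4034192 4036580 4041273 4033449)) (v5 (v5 98713 32538 4099314 101860 6049565) (v5 6052715 112553 35563 4135004 128084) (v5 35588 4144936 163976 6055490 128830) (v5 35603 4112937 115578 6055505 144595) (v5 6054605 160196 35578 4120778 144081)) (v5 (v5 12100969 4096794 51834 7254 128195) (v5 53861 917 114443 14169016 4192844) (v5 5997 176188 12166232 4118748 48820) (v5 4092 176571 12117834 4166391 48709) (v5 51986 1310 130584 14138154 4240845)) (v5 (v5 22182229 4176804 52459 7879 208205) (v5 4727 96173 12116699 4136904 49334) (v5 53236 1552 115073 14120753 4160830) (v5 52611 1935 164606 16152641 4112839) (v5 5362 96566 12132840 4150875 49455)) (v5 (v5 178093 33168 4116840 103135 6050195) (v5 35598 4192937 148345 6055500 144716) (v5 6053345 96808 35568 4168276 208084) (v5 6053975 97191 35573 4120013 224101) (v5 35593 4224956 131834 6055495 128709)))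

table21 : Trie 4
table21 = v5 (v5 (v5 (v5 1272 160298 12102594 12105769 160323) (v5 4037869 6050551 52465 7622 32700) (v5 4036855 32670 5717 55640 6050576) (v5 4038617 32675 4447 55005 6050591) (v5 4037603 6050566 51830 8892 32695)) (v5 (v5 259 32660 4115186 4118361 32685) (v5 4036589 160303 3812 102878 4096956) (v5 4036215 4096926 100973 6987 160328) (v5 4036107 4096931 99703 6627 160343) (v5 4038858 160318 3452 104148 4096951)) (v5 (v5 32515 4096916 51960 55135 4096941) (v5 4038484 32665 99068 12105134 240096) (v5 4038750 240066 12103229 102243 32690) (v5 4036722 240071 12101959 101883 32705) (v5 4036988 32680 98708 12106404 240091)) (v5 (v5 1905 240056 5082 8257 240081) (v5 4037229 4096921 12101324 4120901 6050586) (v5 4038110 6050556 4115821 12104499 4096946) (v5 4037362 6050561 4117726 12104139 4096961) (v5 4038243 4096936 12100964 4118996 6050581)) (v5 (v5 48020 6050546 100338 103513 6050571) (v5 4035974 240061 4117091 54500 160338) (v5 4037470 160308 51195 4120266 240086) (v5 4037977 160313 51325 4119631 240101) (v5 4036348 240076 4116456 54370 160333))) (v5 (v5 (v5 4472 112545 12165719 16154022 128700) (v5 5742 33170 4037592 6055876 48705) (v5 35850 1297 53221 6056891 4034453) (v5 6054616 4033680 35820 7630 49340) (v5 52474 1559 35825 4041019 6049576)) (v5 (v5 99728 909 114435 4118489 4033440) (v5 35835 284 35060 4119129 4112835) (v5 3837 96553 4117602 4039239 128831) (v5 4036233 4112934 131331 7005 144722) (v5 6352 96815 4036082 4120524 128206))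 (v5 (v5 12101984 96165 35830 4039884 144072) (v5 4038738 32540 114565 14121134 224097) (v5 53749 4224943 35690 4134750 48821) (v5 35840 176568 12133587 102261 4033838) (v5 35855 4033559 114580 14138535 208216)) (v5 (v5 22183244 4192929 4037337 6056886 4240836) (v5 6053356 4096796 12116821 4168657 4034085) (v5 6053986 4034179 4099946 14168127 4160831) (v5 5107 1932 133231 8255 128090) (v5 4038118 4144943 12116836 4151256 6050206)) (v5 (v5 179108 4034295 163463 4167517 49446) (v5 51224 4176806 148472 4039124 144591) (v5 4037473 160183 51321 4136650 208085) (v5 53099 97188 4036327 103511 4192850) (v5 6052096 176195 163333 6055246 48070))) (v5 (v5 (v5 5730 128674 16150471 12168894 112570) (v5 6054245 49299 4709 38995 4033705) (v5 4480 48674 6054220 4040767 33195) (v5 53865 6049555 4036828 39000 1584) (v5 36345 4034442 6052705 56396 1322)) (v5 (v5 100986 4033414 4115568 117610 934) (v5 4036590 144681 3434 134506 4112959) (v5 35085 4112804 4117478 38235 309) (v5 3855 128185 4116333 4039257 96840) (v5 6355 128820 4036208 4120777 96578)) (v5 (v5 12103242 144046 4036963 39005 96190) (v5 37605 4033797 98690 12136762 176593) (v5 4038500 224066 14119483 117740 32565) (v5 35715 208195 14133709 117755 4033584) (v5 51985 48810 4131209 38865 4224968)) (v5 (v5 22184502 4240810 6053335 4040512 4192954) (v5 5105 128049 5334 136406 1957) (v5 6054235 4034054 4163831 12119996 4096821) (v5 4037235 6050185 4149605 12120011 4144968) (v5 6054240 4160820 14165096 4103121 4034204)) (v5 (v5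 180366 49420 4164596 166638 4034320) (v5 51350 4192809 100590 4039502 97213) (v5 52595 144560 4036323 151647 4176831) (v5 6054225 48049 6052075 166508 176220) (v5 4035970 208074 4132459 54496 160208))) (v5 (v5 (v5 4734 128675 16150847 12168772 112573) (v5 36993 4034428 6053716 54999 1330) (v5 51855 6049551 4037844 39513 1572) (v5 5984 48680 6052701 4040005 33213) (v5 6053726 49315 4455 40143 4033703)) (v5 (v5 99990 4033415 4115314 117613 937) (v5 4084 128806 4036064 4119380 96586) (v5 3459 128181 4117349 4039365 96828) (v5 35103 4112810 4115954 38253 327) (v5 4038857 144697 3830 135649 4112957)) (v5 (v5 12102246 144047 4036709 38883 96193) (v5 53735 48796 4131575 40773 4224976) (v5 37623 208191 14135360 118118 4033572) (v5 4036972 224072 14117959 118133 32583) (v5 35733 4033813 99086 12137905 176591)) (v5 (v5 22183506 4240811 6053711 4040385 4192957) (v5 6053731 4160806 14164952 4105029 4034212) (v5 4038237 6050181 4148081 12120374 4144956) (v5 6053736 4034060 4165482 12120389 4096839) (v5 5359 128065 5080 134374 1955)) (v5 (v5 179370 49421 4164342 166516 4034323) (v5 4036352 208060 4133475 54374 160216) (v5 6053721 48045 6052071 167146 176208) (v5 53100 144566 4035949 150885 4176849) (v5 51220 4192825 100336 4039120 97211))) (v5 (v5 (v5 5992 112548 12165597 16153646 128699) (v5 53246 1547 36338 4040003 6049580) (v5 6052730 4033678 36968 7884 49324) (v5 38113 1305 51824 6055880 4034467) (v5 4722 33188 4036830 6057395 48699)) (v5 (v5 101248 912 114438 4118743 4033439)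 (v5 4087 96803 4036190 4119508 128210) (v5 4036089 4112932 132474 6609 144706) (v5 3477 96561 4116205 4039383 128845) (v5 38103 302 35078 4120653 4112829)) (v5 (v5 12103504 96168 35708 4040138 144071) (v5 38108 4033547 114943 14136884 208220) (v5 38123 176566 12134730 101865 4033822) (v5 51971 4224951 37598 4134384 48835) (v5 4036734 32558 114958 14122658 224091)) (v5 (v5 22184764 4192932 4037210 6056510 4240835) (v5 4037354 4144931 12117199 4152780 6050210) (v5 5357 1930 131199 8509 128074) (v5 6053360 4034187 4101854 14168271 4160845) (v5 6053990 4096814 12117214 4167006 4034079)) (v5 (v5 180628 4034298 163341 4167771 49445) (v5 6052100 176183 163971 6055250 48074) (v5 52596 97186 4035945 103765 4192834) (v5 4037974 160191 51199 4135634 208099) (v5 51346 4176824 147710 4039498 144585)))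

table22 : Trie 4
table22 = v5 (v5 (v5 (v5 1275 160676 14118341 14121516 160701) (v5 4037997 33295 5087 55125 6049830) (v5 4036604 6049800 53220 8262 33320) (v5 4038868 6049805 51950 7627 33335) (v5 4037475 33310 4452 56395 6049825)) (v5 (v5 48014 6049790 130565 133740 6049815) (v5 4036717 160681 51315 4150883 112080) (v5 4035964 112050 4148978 54490 160706) (v5 4036358 112055 4147708 54380 160721) (v5 4038730 160696 51205 4152153 112075)) (v5 (v5 889 112040 4082 7257 112065) (v5 4038612 6049795 4147073 14120881 4176966) (v5 4038499 4176936 14118976 4150248 6049820) (v5 4036973 4176941 14117706 4150638 6049835) (v5 4036860 6049810 4147463 14122151 4176961)) (v5 (v5 33150 4176926 52585 55760 4176951) (v5 4037357 112045 14117071 136280 33330) (v5 4037859 33300 131200 14120246 112070) (v5 4037613 33305 133105 14120261 112085) (v5 4038115 112060 14117086 134375 33325)) (v5 (v5 264 33290 4148343 4151518 33315) (v5 4036102 4176931 132470 6622 160716) (v5 4037219 160686 3817 135645 4176956) (v5 4038228 160691 3447 135010 4176971) (v5 4036220 4176946 131835 6992 160711))) (v5 (v5 (v5 5112 96795 12134222 14169397 144576) (v5 6053996 4034300 36460 7625 48831) (v5 4477 32545 4037972 6056516 49325) (v5 53739 1302 35695 4039754 6050216) (v5 36470 1937 51956 6057146 4033450)) (v5 (v5 100368 4033539 130691 4134745 48690) (v5 51839 112550 4036317 102881 4160841) (v5 51214 4096801 164098 4039114 144707) (v5 6052106 96558 115200 6055256 48080) (v5 4038733 97193 51331 4120399 144082))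 (v5 (v5 12102624 4144923 4036962 6055886 4112820) (v5 6357 914 114440 9525 208095) (v5 6054626 4176811 12166354 4118619 4033823) (v5 4036848 4224948 12117456 4166137 6049586) (v5 6052736 4033685 4115462 14122404 4240846)) (v5 (v5 22183884 176175 36455 4040509 224082) (v5 36475 96170 12116696 104781 4034463) (v5 4038113 33175 115070 14136630 128075) (v5 36480 4034184 149107 16152392 128216) (v5 53114 4112939 36325 4166752 49456)) (v5 (v5 179748 1539 131966 4136020 4034070) (v5 4036228 4192934 163968 7000 128841) (v5 36465 289 35065 4152526 4192835) (v5 5722 160188 4036077 4119759 208226) (v5 3842 176573 4100581 4039244 128710))) (v5 (v5 (v5 4475 144550 14166476 12137397 96820) (v5 53245 6050175 4037468 38870 1327) (v5 6052980 48800 5339 39635 4034325) (v5 37610 4033429 6052950 55131 1962) (v5 5100 49314 6052955 4041147 32570)) (v5 (v5 99731 48664 4131189 133866 4033564) (v5 6052965 48039 6052065 118375 96583) (v5 51340 4160810 100595 4039492 112575) (v5 4035980 144061 4116208 54506 97218) (v5 53855 144696 4036333 167273 4096826)) (v5 (v5 12101987 4112794 6052960 4040137 4144948) (v5 4038485 6049545 4163326 12120631 4224973) (v5 6375 208064 4064 117615 939) (v5 6052970 4240825 14118213 4118637 4033710) (v5 6052985 4033812 4115588 12169529 4176836)) (v5 (v5 22183247 224056 4037588 39630 176200) (v5 36350 128175 16149201 152282 4034209) (v5 36980 4034432 99320 12119871 96195) (v5 52610 49435 4165736 39500 4112964) (v5 4037865 128064 14133089 118245 33200)) (v5 (v5 179111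 4034044 4132464 135141 1564) (v5 3850 208185 4117473 4039252 160213) (v5 4037220 128810 3439 167143 4192959) (v5 5725 128689 4036203 4103756 176598) (v5 35090 4192824 4148335 38240 314))) (v5 (v5 (v5 5989 144551 14166222 12137270 96823) (v5 5364 49300 6053341 4039750 32578) (v5 35728 4033425 6053971 55639 1950) (v5 6054991 48806 4450 38878 4034343) (v5 52475 6050191 4036579 40643 1325)) (v5 (v5 101245 48665 4131570 133739 4033567) (v5 51840 144682 4035939 165881 4096834) (v5 4036342 144057 4117224 54364 97206) (v5 51230 4160816 99706 4039130 112593) (v5 6054981 48055 6052081 119523 96581)) (v5 (v5 12103501 4112795 6052711 4040010 4144951) (v5 6054986 4033798 4115444 12168137 4176844) (v5 6055001 4240821 14119229 4118745 4033698) (v5 4089 208070 6350 117633 957) (v5 4036987 6049561 4162962 12121779 4224971)) (v5 (v5 22184761 224057 4037334 39508 176203) (v5 4037607 128050 14133455 120153 33208) (v5 53110 49431 4163577 40138 4112952) (v5 36358 4034438 101606 12119889 96213) (v5 36988 128191 16149217 150250 4034207)) (v5 (v5 180625 4034045 4132845 135014 1567) (v5 35098 4192810 4149351 38248 322) (v5 4714 128685 4036069 4104394 176586) (v5 4038227 128816 3825 166511 4192977) (v5 3464 208201 4116584 4039370 160211))) (v5 (v5 (v5 5352 96798 12134095 14169651 144575) (v5 37493 1925 52464 6056125 4033454) (v5 51981 1300 37468 4040643 6050200) (v5 5987 32553 4036575 6056130 49339) (v5 6053350 4034318 35703 8514 48825)) (v5 (v5 100608 4033542 130564 4134364 48689)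 (v5 4036714 97181 51189 4119383 144086) (v5 6052090 96556 116348 6055240 48064) (v5 51356 4096809 162706 4039508 144721) (v5 53856 112568 4035955 103770 4160835)) (v5 (v5 12102864 4144926 4036835 6056135 4112819) (v5 6054610 4033673 4115570 14121388 4240850) (v5 4038624 4224946 12118604 4166501 6049570) (v5 6052720 4176819 12164962 4118763 4033837) (v5 4107 932 114458 7239 208089)) (v5 (v5 22184124 176178 36333 4040763 224081) (v5 52606 4112927 36963 4168911 49460) (v5 37483 4034182 147075 16152376 128200) (v5 4037359 33183 116978 14136264 128089) (v5 37488 96188 12116714 102495 4034457)) (v5 (v5 179988 1542 131839 4135639 4034069) (v5 3472 176561 4101219 4039378 128714) (v5 4717 160186 4036195 4120648 208210) (v5 37473 297 35073 4151510 4192849) (v5 4036094 4192952 163336 6614 128835)))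

table23 : Trie 4
table23 = v5 (v5 (v5 (v5 894 112670 14150223 14153398 112695) (v5 4038120 33673 4712 55000 6049956) (v5 4036983 6049926 53095 7887 33698) (v5 4038489 6049931 51825 7252 33713) (v5 4037352 33688 4077 56270 6049951)) (v5 (v5 48015 6049916 146441 149616 6049941) (v5 4036840 112675 51190 4135382 160086) (v5 4036343 160056 4133477 54365 112700) (v5 4035979 160061 4132207 54505 112715) (v5 4038607 112690 51330 4136652 160081)) (v5 (v5 1270 160046 4457 7632 160071) (v5 4038735 6049921 4131572 14152763 4177344) (v5 4038878 4177314 14150858 4134747 6049946) (v5 4036594 4177319 14149588 4134387 6049961) (v5 4036737 6049936 4131212 14154033 4177339)) (v5 (v5 33153 4177304 52460 55635 4177329) (v5 4037480 160051 14148953 152156 33708) (v5 4038238 33678 147076 14152128 160076) (v5 4037234 33683 148981 14152518 160091) (v5 4037992 160066 14149343 150251 33703)) (v5 (v5 267 33668 4132842 4136017 33693) (v5 4036225 4177309 148346 6997 112710) (v5 4037598 112680 3442 151521 4177334) (v5 4037849 112685 3822 150886 4177349) (v5 4036097 4177324 147711 6617 112705))) (v5 (v5 (v5 5727 97173 12118091 14137900 128826) (v5 37115 1544 52591 6056251 4033833) (v5 51854 919 37090 4040514 6050201) (v5 6362 32550 4036952 6056256 49466) (v5 6053351 4034189 35700 8895 48700)) (v5 (v5 100983 4033665 146567 4150621 48816) (v5 4036843 96800 51316 4166882 128085) (v5 6052091 96175 132601 6055241 48065) (v5 51229 4096806 115075 4039129 128720) (v5 53729 160193 4036332 104151 4112830))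 (v5 (v5 12103239 4112919 4036712 6056261 4160826) (v5 6054611 4033544 4115697 16153387 4192845) (v5 4038753 4192939 12134857 4118494 6049571) (v5 6052721 4176816 12117331 4134765 4033460) (v5 4482 1307 162083 7620 224092)) (v5 (v5 22184499 176553 36330 4040384 208080) (v5 52479 4144928 36960 4121029 49335) (v5 37105 4034305 131326 14120499 128201) (v5 4037488 33180 164603 14168017 144092) (v5 37110 96563 12164339 102876 4034080)) (v5 (v5 180363 1917 115835 4119889 4034448) (v5 3847 176180 4101216 4039249 144717) (v5 5092 112555 4036072 4168022 208211) (v5 37095 294 35070 4136015 4240856) (v5 4036223 4224953 115705 6995 144586))) (v5 (v5 (v5 6370 128800 14134344 12121266 97198) (v5 5745 49425 6053340 4040127 32575) (v5 35725 4033802 6053970 55766 1569) (v5 6054865 48679 4069 38875 4034214) (v5 52600 6050190 4036958 40265 944)) (v5 (v5 101626 48790 4147065 149742 4033690) (v5 51965 128679 4036318 118250 4096831) (v5 4035965 128054 4165231 54491 96825) (v5 51355 4112809 99325 4039507 160218) (v5 6054855 48054 6052080 135776 96200)) (v5 (v5 12103882 4160800 6052710 4039887 4112944) (v5 6054860 4033419 4131194 12120506 4176841) (v5 6054875 4192814 16151106 4118872 4033569) (v5 4470 224071 5969 165258 1332) (v5 4036610 6049560 4115713 12138032 4192964)) (v5 (v5 22185142 208054 4037463 39505 176578) (v5 4037230 144051 14165206 167778 33205) (v5 53235 49304 4116203 40135 4144953) (v5 36355 4034059 101225 12167514 96588) (v5 36985 128190 14117468 134501 4034330)) (v5 (v5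 181006 4034422 4116968 119010 1942) (v5 35095 4240815 4133094 38245 319) (v5 5095 144686 4036198 4104391 176205) (v5 4037850 144565 3444 118880 4224978) (v5 3845 208200 4164466 4039247 112580))) (v5 (v5 (v5 4094 128801 14134725 12121144 97201) (v5 53120 6050176 4037339 38873 952) (v5 6053106 48675 5720 40013 4034202) (v5 37613 4033808 6053076 55004 1587) (v5 4719 49441 6053081 4041270 32573)) (v5 (v5 99350 48791 4147446 149615 4033693) (v5 6053091 48040 6052066 134379 96208) (v5 51215 4112805 100976 4039115 160206) (v5 4036357 128060 4163707 54379 96843) (v5 53730 128695 4035954 120023 4096829)) (v5 (v5 12101606 4160801 6053086 4039760 4112947) (v5 4038862 6049546 4115319 12136635 4192972) (v5 5994 224067 4445 165246 1320) (v5 6053096 4192820 16150212 4118510 4033587) (v5 6053111 4033435 4131590 12122279 4176839)) (v5 (v5 22182866 208055 4037209 40008 176581) (v5 36353 128176 14117324 136279 4034338) (v5 36983 4034055 99701 12167502 96576) (v5 52485 49310 4117854 39503 4144971) (v5 4038242 144067 14164842 165876 33203)) (v5 (v5 178730 4034423 4116714 118888 1945) (v5 3469 208186 4164847 4039375 112588) (v5 4037597 144561 3820 119518 4224966) (v5 5344 144692 4036074 4103759 176223) (v5 35093 4240831 4132840 38243 317))) (v5 (v5 (v5 4737 97176 12117969 14137519 128825) (v5 6053995 4034177 36838 7244 48704) (v5 4102 32548 4038095 6056515 49450) (v5 53866 927 35698 4040133 6050215) (v5 36848 1562 51829 6057145 4033827)) (v5 (v5 99993 4033668 146440 4150240 48815)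 (v5 51966 160181 4035940 102500 4112834) (v5 51341 4096804 116848 4039493 128704) (v5 6052105 96183 131204 6055255 48079) (v5 4038604 96818 51204 4168406 128079)) (v5 (v5 12102249 4112922 4036585 6055885 4160825) (v5 5982 1295 162071 9144 224096) (v5 6054625 4176814 12119104 4134369 4033444) (v5 4036719 4192947 12133460 4118888 6049585) (v5 6052735 4033562 4115335 16154281 4192839)) (v5 (v5 22183509 176556 36833 4040638 208079) (v5 36853 96551 12164327 104400 4034084) (v5 4037984 33178 162701 14168381 144076) (v5 36858 4034313 133104 14120643 128215) (v5 53241 4144946 36328 4119378 49329)) (v5 (v5 179373 1920 115713 4120143 4034447) (v5 4036099 4224941 116343 6619 144590) (v5 36843 292 35068 4136269 4240840) (v5 5347 112563 4036200 4167641 208225) (v5 3467 176198 4100584 4039373 144711)))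

table24 : Trie 4
table24 = v5 (v5 (v5 (v5 897 113048 12102219 12105394 113073) (v5 4038248 6050425 52590 7247 33078) (v5 4036732 33048 5342 55765 6050450) (v5 4038740 33053 4072 55130 6050465) (v5 4037224 6050440 51955 8517 33073)) (v5 (v5 262 33038 4162814 4165989 33063) (v5 4036968 113053 3437 102503 4097334) (v5 4036092 4097304 100598 6612 113078) (v5 4036230 4097309 99328 7002 113093) (v5 4038479 113068 3827 103773 4097329)) (v5 (v5 32518 4097294 51835 55010 4097319) (v5 4038863 33043 98693 12104759 192090) (v5 4038627 192060 12102854 101868 33068) (v5 4036845 192065 12101584 102258 33083) (v5 4036609 33058 99083 12106029 192085)) (v5 (v5 1524 192050 4707 7882 192075) (v5 4037608 4097299 12100949 4168529 6050460) (v5 4037987 6050430 4163449 12104124 4097324) (v5 4037485 6050435 4165354 12104514 4097339) (v5 4037864 4097314 12101339 4166624 6050455)) (v5 (v5 48019 6050420 99963 103138 6050445) (v5 4036353 192055 4164719 54375 113088) (v5 4037347 113058 51320 4167894 192080) (v5 4038100 113063 51200 4167259 192095) (v5 4035969 192070 4164084 54495 113083))) (v5 (v5 (v5 6367 160173 12117966 14121769 144702) (v5 53119 1922 36335 4039874 6049581) (v5 6052731 4033549 36965 8265 49451) (v5 37735 924 51951 6055881 4034090) (v5 5097 33185 4036707 6057521 48826)) (v5 (v5 101623 1287 162063 4166117 4033818) (v5 4462 97178 4036067 4135385 128211) (v5 4036218 4144933 116470 6990 128705) (v5 3852 96180 4116332 4039254 144596) (v5 37725 299 35075 4168152 4160836))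 (v5 (v5 12103879 96543 35705 4039759 128070) (v5 37730 4033670 162193 14168762 208221) (v5 37745 176185 12118726 102246 4033445) (v5 51844 4192944 37595 4118509 48710) (v5 4036863 32555 130711 16154657 208090)) (v5 (v5 22185139 4224933 4037587 6056511 4192830) (v5 4037483 4112924 12164449 4137285 6050211) (v5 5732 1549 147202 8890 144077) (v5 6053361 4034310 4101851 14136645 4112840) (v5 6053991 4096811 12132967 4119124 4034458)) (v5 (v5 181003 4034169 115710 4119764 49320) (v5 6052101 176558 116340 6055251 48075) (v5 52469 96805 4036322 104146 4240841) (v5 4038103 112560 51326 4151891 224102) (v5 51219 4176821 131961 4039119 128836))) (v5 (v5 (v5 5115 144676 14118848 12121141 160198) (v5 36990 4034049 6053590 55126 949) (v5 51980 6049550 4038223 39510 1947) (v5 6365 48805 6052700 4039882 33210) (v5 6053600 49440 4074 40140 4033574)) (v5 (v5 100371 4033792 4163196 165238 1312) (v5 4465 144555 4036193 4119507 96205) (v5 3840 128180 4133099 4039242 97203) (v5 35100 4160815 4163961 38250 324) (v5 4038480 128694 3449 119645 4144958)) (v5 (v5 12102627 128044 4036838 38880 96568) (v5 53860 48669 4115698 40770 4192969) (v5 37620 208190 14167111 165368 4033695) (v5 4036595 208069 16149836 133886 32580) (v5 35730 4033434 98705 12121901 176210)) (v5 (v5 22183887 4192804 6053585 4040762 4224958) (v5 6053605 4112799 14133074 4105026 4034335) (v5 4037860 6050180 4131824 12167624 4112949) (v5 6053610 4034437 4118108 12136142 4096836) (v5 5740 144066 4699 150377 1574)) (v5 (v5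 179751 49294 4116843 118885 4034194) (v5 4035975 224061 4148970 54501 112585) (v5 6053595 48044 6052070 119515 176583) (v5 53225 128815 4036328 135136 4176846) (v5 51345 4240830 99955 4039497 96830))) (v5 (v5 (v5 5349 144677 14118594 12121644 160201) (v5 6054371 49426 5090 39373 4033582) (v5 4099 48801 6054346 4040390 33198) (v5 53740 6049556 4036699 39378 1965) (v5 36348 4034065 6052706 56269 947)) (v5 (v5 100605 4033793 4162942 165241 1315) (v5 4036967 128680 3815 118253 4144966) (v5 35088 4160811 4164977 38238 312) (v5 3474 128186 4132210 4039380 97221) (v5 5974 144571 4036079 4120650 96203)) (v5 (v5 12102861 128045 4036584 39383 96571) (v5 37608 4033420 99071 12120509 176218) (v5 4038877 208065 16151482 133744 32568) (v5 35718 208196 14165587 165761 4033713) (v5 51860 48685 4115334 38868 4192967)) (v5 (v5 22184121 4192805 6053336 4040635 4224961) (v5 4724 144052 5715 152155 1582) (v5 6054361 4034433 4115949 12136000 4096824) (v5 4037612 6050186 4134110 12168017 4112967) (v5 6054366 4112815 14133470 4103124 4034333)) (v5 (v5 179985 49295 4116589 119388 4034197) (v5 51225 4240816 100971 4039125 96838) (v5 52470 128811 4035944 135644 4176834) (v5 6054351 48050 6052076 118883 176601) (v5 4036347 224077 4148716 54369 112583))) (v5 (v5 (v5 4097 160176 12118469 14122023 144701) (v5 5367 33173 4037215 6055875 48830) (v5 36228 922 53094 6056765 4034074) (v5 6054615 4033557 36198 7249 49465) (v5 52601 1940 36203 4041398 6049575)) (v5 (v5 99353 1290 162066 4166371 4033817)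 (v5 36213 287 35063 4167136 4160840) (v5 3462 96178 4117475 4039368 144580) (v5 4036104 4144941 115078 6624 128719) (v5 5977 97196 4036205 4136274 128205)) (v5 (v5 12101609 96546 36208 4040013 128069) (v5 4038609 32543 130569 16153011 208094) (v5 53876 4192942 35693 4118873 48694) (v5 36218 176193 12117334 101880 4033459) (v5 36233 4033688 162586 14170286 208215)) (v5 (v5 22182869 4224936 4037460 6056760 4192829) (v5 6053355 4096799 12132825 4121283 4034462) (v5 6053985 4034308 4099949 14136249 4112824) (v5 4732 1557 148980 7874 144091) (v5 4037989 4112942 12164842 4134999 6050205)) (v5 (v5 178733 4034172 116213 4120018 49319) (v5 51351 4176809 132469 4039503 128840) (v5 4037344 112558 51194 4152145 224086) (v5 53226 96813 4035950 103130 4240855) (v5 6052095 176576 115708 6055245 48069)))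

table30 : Trie 4
table30 = v5 (v5 (v5 (v5 381 48032 3557 6732 48057) (v5 6053993 6050173 6053338 6055873 6049578) (v5 6052728 6049548 6053968 6056513 6050198) (v5 6054613 6049553 6052698 6055878 6050213) (v5 6053348 6050188 6052703 6057143 6049573)) (v5 (v5 48012 6049538 98813 101988 6049563) (v5 6052713 48037 6052063 118379 128208) (v5 6052088 128178 116474 6055238 48062) (v5 6052103 128183 115204 6055253 48077) (v5 6054603 48052 6052078 119649 128203)) (v5 (v5 1017 128168 6052708 6055883 128193) (v5 6054608 6049543 114569 9272 208218) (v5 6054623 208188 4192 117744 6049568) (v5 6052718 208193 6097 118134 6049583) (v5 6052733 6049558 114959 7367 208213)) (v5 (v5 1652 208178 6053333 6056508 208203) (v5 6053353 128173 5462 104528 6050208) (v5 6053983 6050178 99448 8637 128198) (v5 6053358 6050183 101353 8002 128213) (v5 6053988 128188 4827 102623 6050203)) (v5 (v5 48017 6050168 115839 119014 6050193) (v5 6052098 208183 100718 6055248 48072) (v5 6053343 48042 6052068 103893 208208) (v5 6053973 48047 6052073 103258 208223) (v5 6052093 208198 100083 6055243 48067))) (v5 (v5 (v5 3581 32031 3683 38737 432) (v5 6054375 6050426 6053594 6056001 6049707) (v5 6053110 6049927 6054474 6056641 6050327) (v5 6054995 6049806 6052954 6056131 6050720) (v5 6053730 6050567 6053209 6057396 6050080)) (v5 (v5 98837 4033287 98939 4102993 48438) (v5 51588 113054 4035937 134503 4144839) (v5 4035962 160057 4117097 54488 128453) (v5 4035977 112056 4163580 54503 144344) (v5 53478 160319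 4035952 151274 4128832)) (v5 (v5 12101093 112419 4333 39387 4128948) (v5 6106 33044 4131448 12136759 176469) (v5 38124 4177315 14119102 118122 1067) (v5 36219 4176942 16150090 149384 1208) (v5 4231 32681 4115207 12153530 176338)) (v5 (v5 22182353 192429 4958 40012 4208958) (v5 36854 4097300 14164825 151904 1833) (v5 5481 33679 4163450 12120378 96323) (v5 4856 33306 4117727 12151640 96464) (v5 37489 4096937 14133343 134123 1702)) (v5 (v5 178217 4033917 100214 4104268 49068) (v5 4035972 192056 4133348 54498 97089) (v5 52218 112681 4035942 120022 4224839) (v5 52848 160692 4035947 167015 4208852) (v5 4035967 240077 4148589 54493 96958))) (v5 (v5 (v5 3707 406 35181 6858 32056) (v5 6054122 6050679 6053845 6056129 6049831) (v5 6052857 6049676 6054350 6056769 6050451) (v5 6054742 6050059 6053205 6056384 6050592) (v5 6053477 6050316 6053085 6057649 6049952)) (v5 (v5 98963 48412 4099437 102114 4033312) (v5 4036462 144303 51187 4166755 112081) (v5 51212 4144808 132222 4039112 113079) (v5 51227 4128811 147078 4039127 160344) (v5 4038352 128442 51202 4120272 160082)) (v5 (v5 12101219 4128922 35831 7508 112444) (v5 38112 1167 146193 16153265 4176967) (v5 6247 176438 12134478 4134623 33069) (v5 4342 176317 12149334 4118382 32706) (v5 36237 1056 114581 14122277 4177340)) (v5 (v5 22182479 4208932 36456 8133 192454) (v5 4977 96423 12148449 4120902 33331) (v5 37487 1802 146823 14168000 4097325) (v5 36862 1681 132852 14136518 4096962) (v5 5612 96312 12116837 4166625 33704)) (v5 (v5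 178343 49042 4100712 103389 4033942) (v5 51222 4208811 164094 4039122 160717) (v5 4037092 97058 51192 4136523 192081) (v5 4037722 96937 51197 4151764 240102) (v5 51217 4224828 115831 4039117 112706))) (v5 (v5 (v5 3582 407 35562 6731 32059) (v5 6054499 6050302 6053466 6056252 6049960) (v5 6053234 6050055 6054221 6056892 6050580) (v5 6055119 6049682 6052826 6056007 6050469) (v5 6053854 6050695 6052956 6057272 6049829)) (v5 (v5 98838 48413 4099818 101987 4033315) (v5 4036465 128428 51313 4119505 160090) (v5 51338 4128807 148099 4039490 160332) (v5 51353 4144814 131328 4039505 113097) (v5 4038355 144319 51328 4167903 112079)) (v5 (v5 12101094 4128923 36212 7381 112447) (v5 37731 1042 114947 14120885 4177348) (v5 6122 176313 12150355 4118370 32694) (v5 4217 176444 12133584 4134511 33087) (v5 35856 1183 146209 16154408 4176965)) (v5 (v5 22182354 4208933 36837 8006 192457) (v5 4852 96298 12117203 4168533 33712) (v5 37106 1677 130948 14136376 4096950) (v5 36481 1808 148729 14168393 4097343) (v5 5487 96439 12148465 4119000 33329)) (v5 (v5 178218 49043 4101093 103262 4033945) (v5 51348 4224814 116847 4039500 112714) (v5 4037095 96933 51318 4152272 240090) (v5 4037725 97064 51323 4135761 192099) (v5 51343 4208827 163840 4039495 160715))) (v5 (v5 (v5 3708 32034 3556 38356 431) (v5 6054246 6050555 6053717 6056380 6050084) (v5 6052981 6049804 6054097 6057020 6050704) (v5 6054866 6049935 6053077 6056260 6050341) (v5 6053601 6050444 6052832 6057525 6049701)) (v5 (v5 98964 4033290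 98812 4102612 48437) (v5 51587 160307 4036315 150253 4128836) (v5 4036340 112054 4164728 54362 144328) (v5 4036355 160065 4116330 54377 128467) (v5 53477 113072 4036330 135397 4144833)) (v5 (v5 12101220 112422 4206 39006 4128947) (v5 6233 32669 4115195 12152509 176342) (v5 37749 4176940 16151233 149368 1192) (v5 35844 4177323 14117710 117756 1081) (v5 4358 33062 4131336 12137653 176463)) (v5 (v5 22182480 192432 4831 39631 4208957) (v5 36479 4096925 14133201 136027 1706) (v5 5608 33304 4115825 12151624 96448) (v5 4983 33687 4165358 12120012 96337) (v5 37114 4097318 14165218 149998 1827)) (v5 (v5 178344 4033920 100087 4103887 49067) (v5 4036350 240065 4149097 54372 96962) (v5 52217 160690 4036320 167269 4208836) (v5 52847 112689 4036325 119006 4224853) (v5 4036345 192074 4132586 54367 97083)))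

table31 : Trie 4
table31 = v5 (v5 (v5 (v5 1021 128672 14134472 14137647 128697) (v5 6054121 49423 4837 39374 4033452) (v5 6053107 4033422 37469 8012 49448) (v5 6054869 4033427 36199 7377 49463) (v5 6053855 49438 4202 40644 4033447)) (v5 (v5 32011 4033412 114564 117739 4033437) (v5 6052841 128677 35564 4103630 144084) (v5 6052467 144054 4101725 38739 128702) (v5 6052359 144059 4100455 38379 128717) (v5 6055110 128692 35204 4104900 144079)) (v5 (v5 1143 144044 4332 7507 144069) (v5 6054736 4033417 4099820 14137012 4240848) (v5 6055002 4240818 14135107 4102995 4033442) (v5 6052974 4240823 14133837 4102635 4033457) (v5 6053240 4033432 4099460 14138282 4240843)) (v5 (v5 33657 4240808 36834 40009 4240833) (v5 6053481 144049 14133202 120279 49458) (v5 6054362 49428 115199 14136377 144074) (v5 6053614 49433 117104 14136517 144089) (v5 6054495 144064 14133342 118374 49453)) (v5 (v5 392 49418 4101090 4104265 49443) (v5 6052226 4240813 116469 6872 128712) (v5 6053722 128682 3567 119644 4240838) (v5 6054229 128687 3697 119009 4240853) (v5 6052600 4240828 115834 6742 128707))) (v5 (v5 (v5 4221 160299 16150725 12121648 97074) (v5 37494 4033922 6053844 54748 1077) (v5 4036602 33049 5593 55763 6050705) (v5 53488 6049932 4036572 39382 1712) (v5 4846 33311 4036577 6057271 48448)) (v5 (v5 99477 32661 4115187 118117 6049692) (v5 4036587 32036 4035812 150379 96333) (v5 35589 4097305 100849 6055491 144329) (v5 6052485 160062 4132083 38757 96968) (v5 38104 160697 6052334 135773 4128958))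 (v5 (v5 12101733 4096917 4036582 6056136 4144824) (v5 6054990 4033292 4115317 12152635 4224849) (v5 6121 192061 4318 149369 1193) (v5 4036592 4177320 14165460 4103013 6050090) (v5 4036607 6049811 4115332 12138029 4208968)) (v5 (v5 22182993 240057 6053589 55758 176454) (v5 52228 112424 14133328 168285 6050337) (v5 52858 6050431 99574 12151625 96449) (v5 36859 33684 4133983 40007 4128842) (v5 6054370 112061 14117087 149999 49078)) (v5 (v5 178857 6050547 4164215 119392 1818) (v5 3596 192434 4149224 6055376 128463) (v5 6053725 113059 3693 135393 4208837) (v5 5471 112686 6052579 4104263 176348) (v5 50968 4176947 4164085 54118 442))) (v5 (v5 (v5 5602 97048 12118092 16153900 160324) (v5 53117 1671 36461 4039747 6049957) (v5 36232 1046 53092 6057019 4033947) (v5 6237 48427 6053080 4039752 33336) (v5 4037097 6050694 51577 8768 33074)) (v5 (v5 100858 6049666 114561 4118362 32686) (v5 6052842 96927 35186 4135258 160087) (v5 4035837 96302 148098 4038987 32061) (v5 35607 4128937 130952 6055509 160722) (v5 38107 144318 6052460 104024 4097330)) (v5 (v5 12103114 4144798 6053215 4039757 4096942) (v5 4038357 6050049 4099442 14168635 4177345) (v5 6054752 4224818 12150354 4118492 4033317) (v5 4036467 4208947 12133208 4118507 6049836) (v5 4357 1182 146208 7493 192086)) (v5 (v5 22184374 176428 52207 6056764 240082) (v5 36857 4128801 37086 4137158 33709) (v5 53107 6050306 162824 14136503 112449) (v5 6053487 49057 148728 14120262 112086) (v5 53112 96438 12148464 102749 6050456)) (v5 (v5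 180238 1792 115836 4167390 6050572) (v5 3722 176307 4101342 6055754 112711) (v5 4967 128432 6052575 4152399 192459) (v5 53097 421 50947 4167260 4176972) (v5 6052222 4208826 131582 6868 113084))) (v5 (v5 (v5 4862 97049 12118473 16153773 160327) (v5 4037745 6050680 52588 7371 33082) (v5 4227 48423 6054096 4040265 33324) (v5 37736 1052 51573 6056257 4033965) (v5 52598 1687 36207 4040895 6049955)) (v5 (v5 100118 6049667 114942 4118365 32689) (v5 35836 144304 6052316 102627 4097338) (v5 35211 4128933 132598 6055617 160710) (v5 4035855 96308 147204 4039005 32079) (v5 6055109 96943 35582 4136401 160085)) (v5 (v5 12102374 4144799 6052961 4039635 4096945) (v5 6107 1168 146194 9271 192094) (v5 4038375 4208943 12134854 4118870 6049824) (v5 6053224 4224824 12149460 4118885 4033335) (v5 4036485 6050065 4099838 14169783 4177343)) (v5 (v5 22183634 176429 52583 6056637 240085) (v5 52603 96424 12148450 104527 6050464) (v5 6054489 49053 146824 14120250 112074) (v5 52608 6050312 165110 14136391 112467) (v5 37111 4128817 36832 4135126 33707)) (v5 (v5 179498 1793 116217 4167268 6050575) (v5 6052604 4208812 132218 6746 113092) (v5 52593 417 50943 4167898 4176960) (v5 5472 128438 6052201 4151637 192477) (v5 3592 176323 4101088 6055372 112709))) (v5 (v5 (v5 6243 160302 16150598 12121267 97073) (v5 5618 33299 4037090 6056255 48452) (v5 51602 6049930 4037720 39636 1696) (v5 4038865 33057 4196 54752 6050719) (v5 36474 4033940 6053082 56267 1071)) (v5 (v5 101499 32664 4115190 117736 6049691)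 (v5 35839 160685 6052442 134127 4128962) (v5 6052341 160060 4133226 38361 96952) (v5 35229 4097313 99452 6055635 144343) (v5 4038855 32054 4035830 151273 96327)) (v5 (v5 12103755 4096920 4036460 6056390 4144823) (v5 4038860 6049799 4115695 12136383 4208972) (v5 4038875 4177318 14166608 4102617 6050074) (v5 4343 192069 6096 149383 1207) (v5 6052986 4033310 4115710 12153529 4224843)) (v5 (v5 22185015 240060 6053462 55382 176453) (v5 6053606 112049 14117075 151903 49082) (v5 37109 33682 4131951 40261 4128826) (v5 52232 6050439 101352 12151639 96463) (v5 52862 112442 14133216 165999 6050331)) (v5 (v5 180879 6050550 4164093 119011 1817) (v5 50972 4176935 4164723 54122 446) (v5 4968 112684 6052197 4104517 176332) (v5 6054226 113067 3571 134757 4208851) (v5 3718 192452 4148462 6055750 128457)))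

table32 : Trie 4
table32 = v5 (v5 (v5 (v5 1147 144548 12102469 12105644 144573) (v5 6054249 4034047 36839 7497 48702) (v5 6052856 48672 5592 40014 4034072) (v5 6055120 48677 4322 39379 4034087) (v5 6053727 4034062 36204 8767 48697)) (v5 (v5 386 48662 4131317 4134492 48687) (v5 6052969 144553 3687 102753 4112832) (v5 6052216 4112802 100848 6862 144578) (v5 6052610 4112807 99578 6752 144593) (v5 6054982 144568 3577 104023 4112827)) (v5 (v5 32641 4112792 35834 39009 4112817) (v5 6054864 48667 98943 12105009 224094) (v5 6054751 224064 12103104 102118 48692) (v5 6053225 224069 12101834 102008 48707) (v5 6053112 48682 98833 12106279 224089)) (v5 (v5 1778 224054 4957 8132 224079) (v5 6053609 4112797 12101199 4137032 4034082) (v5 6054111 4034052 4131952 12104374 4112822) (v5 6053865 4034057 4133857 12104264 4112837) (v5 6054367 4112812 12101089 4135127 4034077)) (v5 (v5 32016 4034042 100213 103388 4034067) (v5 6052354 224059 4133222 38374 144588) (v5 6053471 144558 35569 4136397 224084) (v5 6054480 144563 35199 4135762 224099) (v5 6052472 224074 4132587 38744 144583))) (v5 (v5 (v5 4861 160677 14166095 12152895 128448) (v5 52868 6050552 4037212 39377 1203) (v5 36229 4033297 6054224 55388 1697) (v5 6111 33054 4036447 6056006 49088) (v5 4037222 33689 4328 56018 6049702)) (v5 (v5 100117 6049791 4131443 133488 1062) (v5 4211 160304 6052569 4103633 96459) (v5 3586 112429 4164850 6055366 96953) (v5 50978 4097310 4115952 54128 452) (v5 6054985 112691 3703 151649 4144834))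 (v5 (v5 12102373 112041 6053214 54758 96318) (v5 38109 32666 4115192 41277 4208847) (v5 53498 192439 16151360 133868 6050075) (v5 6053100 192066 14133963 118137 48458) (v5 51608 6049937 98959 12153905 176464)) (v5 (v5 22183633 4176927 4037207 6056761 4224834) (v5 4037227 4096922 14117197 4105533 6050715) (v5 6054365 4033927 4115822 12136124 4128827) (v5 4037232 6050436 4149859 12120393 4128968) (v5 5486 160067 4953 166380 1828)) (v5 (v5 179497 33291 4132718 150639 6050322) (v5 6052480 240062 4164720 38752 144339) (v5 4037217 32041 4035817 151269 176333) (v5 37474 113064 6052329 119387 4208978) (v5 35594 4177325 100209 6055496 97084))) (v5 (v5 (v5 4347 128422 12149969 14169270 160702) (v5 5617 49047 6053720 4039622 33079) (v5 51852 1172 37091 4040387 6050577) (v5 4038362 6049681 51822 7503 33714) (v5 36852 1686 51827 6057399 4033322)) (v5 (v5 99603 1036 130312 4134618 6049816) (v5 51837 411 50937 4119127 4097335) (v5 3712 96428 4101347 6055744 160329) (v5 6052232 4144813 146828 6878 112716) (v5 6227 96942 6052585 4168025 112454)) (v5 (v5 12101859 96292 51832 6056389 112066) (v5 6054737 48417 114566 14137138 192091) (v5 38127 4208816 35816 4118367 32691) (v5 51842 176443 12149084 102134 6049962) (v5 51857 6050064 130582 16154535 192464)) (v5 (v5 22183119 4224808 6053840 4040382 4176952) (v5 4037102 4128927 12116822 4153034 6050461) (v5 4037732 6050684 4100072 14120372 4096947) (v5 4982 1807 164729 8128 160092) (v5 6054117 4128816 12132838 4118997 4033952)) (v5 (v5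 178983 6050296 147713 4135893 33316) (v5 35602 4208937 116466 6055504 113089) (v5 6053472 144308 35191 4167895 240087) (v5 37477 97063 6052455 103384 4177350) (v5 4035842 176322 147458 4038992 32066))) (v5 (v5 (v5 6117 128423 12149720 14169148 160705) (v5 37116 1672 52213 6056002 4033330) (v5 4036480 6049677 52843 8011 33702) (v5 53863 1178 36202 4039630 6050595) (v5 4847 49063 6052831 4041395 33077)) (v5 (v5 101373 1037 130313 4134491 6049819) (v5 4212 96928 6052191 4166633 112462) (v5 6052594 4144809 148474 6736 112704) (v5 3602 96434 4100458 6055382 160347) (v5 53853 427 50953 4120275 4097333)) (v5 (v5 12103629 96293 51583 6056262 112069) (v5 53858 6050050 130693 16153138 192472) (v5 53873 176439 12150730 101992 6049950) (v5 35841 4208822 38102 4118385 32709) (v5 6053239 48433 114962 14138281 192089)) (v5 (v5 22184889 4224809 6053586 4040260 4176955) (v5 6053859 4128802 12132949 4120905 4033960) (v5 5482 1803 163205 8636 160080) (v5 4037110 6050690 4102358 14120765 4096965) (v5 4037740 4128943 12117218 4151002 6050459)) (v5 (v5 180753 6050297 147464 4135766 33319) (v5 4035850 176308 148094 4039000 32074) (v5 36466 97059 6052321 103892 4177338) (v5 6054479 144314 35577 4167263 240105) (v5 35216 4208953 116212 6055622 113087))) (v5 (v5 (v5 5603 160680 14165973 12153144 128447) (v5 4038245 33677 4836 54997 6049706) (v5 4353 33052 4038220 6056895 49072) (v5 37739 4033305 6052827 55002 1711) (v5 52222 6050570 4036455 40266 1197)) (v5 (v5 100859 6049794 4131316 133487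 1061) (v5 6052966 112679 3561 150003 4144838) (v5 50962 4097308 4117100 54112 436) (v5 3728 112437 4163458 6055760 96967) (v5 6228 160322 6052207 4104522 96453)) (v5 (v5 12103115 112044 6053087 55007 96317) (v5 53482 6049925 98817 12152259 176468) (v5 6054876 192064 14135106 117741 48442) (v5 51592 192447 16149963 133757 6050089) (v5 35859 32684 4115210 38991 4208841)) (v5 (v5 22184375 4176930 4037085 6057015 4224833) (v5 4978 160055 5461 167904 1832) (v5 4038235 6050434 4147827 12119997 4128952) (v5 6053611 4033935 4117730 12136013 4128841) (v5 4038240 4096940 14117590 4103247 6050709)) (v5 (v5 180239 33294 4132591 150888 6050321) (v5 35224 4177313 100717 6055630 97088) (v5 36469 113062 6052447 119641 4208962) (v5 4038225 32049 4035825 150633 176347) (v5 6052346 240080 4164088 38366 144333)))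

table33 : Trie 4
table33 = v5 (v5 (v5 (v5 1022 128798 12102344 12105519 128823) (v5 6054372 4034425 36464 7372 48828) (v5 6053235 48798 5467 39639 4034450) (v5 6054741 48803 4197 39004 4034465) (v5 6053604 4034440 35829 8642 48823)) (v5 (v5 387 48788 4147193 4150368 48813) (v5 6053092 128803 3562 102628 4160838) (v5 6052595 4160808 100723 6737 128828) (v5 6052231 4160813 99453 6877 128843) (v5 6054859 128818 3702 103898 4160833)) (v5 (v5 33022 4160798 36209 39384 4160823) (v5 6054987 48793 98818 12104884 208092) (v5 6055130 208062 12102979 101993 48818) (v5 6052846 208067 12101709 102133 48833) (v5 6052989 48808 98958 12106154 208087)) (v5 (v5 1651 208052 4832 8007 208077) (v5 6053732 4160803 12101074 4152908 4034460) (v5 6054490 4034430 4147828 12104249 4160828) (v5 6053486 4034435 4149733 12104389 4160843) (v5 6054244 4160818 12101214 4151003 4034455)) (v5 (v5 32019 4034420 100088 103263 4034445) (v5 6052477 208057 4149098 38749 128838) (v5 6053850 128808 35194 4152273 208082) (v5 6054101 128813 35574 4151638 208097) (v5 6052349 208072 4148463 38369 128833))) (v5 (v5 (v5 5476 112671 14134598 12137394 144324) (v5 4037867 33296 4963 55123 6050085) (v5 4226 32671 4037842 6056766 49073) (v5 38114 4033302 6053204 55128 1838) (v5 52223 6050441 4036452 40647 1072)) (v5 (v5 100732 6049917 4147319 149364 1188) (v5 6053095 160682 3688 118757 4128837) (v5 50963 4096927 4133353 54113 437) (v5 3601 112434 4115827 6055381 97094) (v5 6101 113069 6052584 4104903 96328))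 (v5 (v5 12102988 160047 6052964 55133 96444) (v5 53483 6049796 98944 12121013 176343) (v5 6055005 240067 14166730 149744 48443) (v5 51593 192444 14117832 149759 6049712) (v5 36234 33059 4162835 39372 4224844)) (v5 (v5 22184248 4177305 4037082 6056636 4208832) (v5 4851 112046 5588 120657 1707) (v5 4037857 6050557 4132078 12152000 4128953) (v5 6053740 4033932 4165355 12152015 4144844) (v5 4037862 4097315 16149720 4103628 6050332)) (v5 (v5 180112 33669 4116587 135138 6050700) (v5 35599 4176932 100844 6055501 96963) (v5 36844 160309 6052324 167650 4208963) (v5 4037847 32046 4035822 134758 176474) (v5 6052475 192071 4116457 38747 128458))) (v5 (v5 (v5 6242 144298 12133843 14137773 112696) (v5 37497 1797 52212 6056379 4033327) (v5 4036477 6050054 52842 8138 33321) (v5 53737 1051 35821 4039627 6050466) (v5 4972 49062 6053210 4041017 32696)) (v5 (v5 101498 1162 146188 4150494 6049942) (v5 4337 97053 6052570 4119002 112459) (v5 6052217 4128806 116471 6863 160707) (v5 3727 96307 4100077 6055759 113094) (v5 53727 426 50952 4136528 4096952)) (v5 (v5 12103754 96418 51582 6056139 160072) (v5 53732 6049671 146443 14121007 192469) (v5 53747 176312 12118727 102119 6049821) (v5 36222 4224823 37721 4166010 33084) (v5 6052862 48432 146458 14169905 240092)) (v5 (v5 22185014 4208806 6053715 4040257 4177330) (v5 6053482 4144803 12148699 4168530 4033957) (v5 5607 1676 115196 8763 112071) (v5 4037107 6050311 4101977 16152895 4097340) (v5 4037737 4128942 12148714 4135253 6050582)) (v5 (v5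 180878 6050674 131587 4119762 33694) (v5 4035847 176433 132217 4038997 32071) (v5 36847 96932 6052450 104019 4176957) (v5 6054102 128437 35196 4119632 192096) (v5 35597 4208952 163459 6055499 160334))) (v5 (v5 (v5 4222 144299 12134219 14137646 112699) (v5 5492 49048 6053591 4039625 32704) (v5 51978 1047 37472 4040765 6050454) (v5 4038365 6050060 51948 7376 33339) (v5 36471 1813 51953 6057522 4033325)) (v5 (v5 99478 1163 146189 4150367 6049945) (v5 51963 412 50938 4135131 4096960) (v5 3587 96303 4101728 6055367 113082) (v5 6052609 4128812 115582 6751 160725) (v5 6102 97069 6052206 4120775 112457)) (v5 (v5 12101734 96419 51958 6056012 160075) (v5 6055114 48418 146569 14168513 240100) (v5 37746 4224819 36197 4165998 33072) (v5 51968 176318 12117838 102007 6049839) (v5 51983 6049687 146584 14122155 192467)) (v5 (v5 22182994 4208807 6053461 4040760 4177333) (v5 4037105 4128928 12148825 4137031 6050590) (v5 4037735 6050307 4100453 16152503 4097328) (v5 4857 1682 117482 8001 112089) (v5 6054494 4144819 12148840 4166628 4033955)) (v5 (v5 178858 6050675 131963 4119640 33697) (v5 35221 4208938 164475 6055627 160342) (v5 6053849 128433 35572 4120270 192084) (v5 37096 96938 6052326 103257 4176975) (v5 4035845 176449 131583 4038995 32069))) (v5 (v5 (v5 4988 112674 14134471 12137018 144323) (v5 52867 6050429 4037590 38996 1076) (v5 35854 4033300 6054347 55387 1822) (v5 6238 32679 4036450 6056385 49087) (v5 4037600 33314 4201 56017 6050079)) (v5 (v5 100244 6049920 4147192 149363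 1187) (v5 4338 113057 6052192 4103252 96332) (v5 3713 112432 4117600 6055745 97078) (v5 50977 4096935 4131956 54127 451) (v5 6054856 160700 3576 119646 4128831)) (v5 (v5 12102500 160050 6052837 54757 96443) (v5 37734 33047 4162823 40896 4224848) (v5 53497 192442 14118980 149618 6049696) (v5 6052971 240075 14165338 149633 48457) (v5 51607 6049814 98832 12121902 176337)) (v5 (v5 22183760 4177308 4037585 6056890 4208831) (v5 4037605 4097303 16149328 4105152 6050336) (v5 6054236 4033930 4163453 12151874 4144828) (v5 4037610 6050565 4133856 12151889 4128967) (v5 5613 112064 4826 118371 1701)) (v5 (v5 179624 33672 4116465 134762 6050699) (v5 6052351 192059 4117095 38371 128462) (v5 4037595 32044 4035820 135392 176458) (v5 37099 160317 6052452 166634 4208977) (v5 35219 4176950 100082 6055625 96957)))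

table34 : Trie 4
table34 = v5 (v5 (v5 (v5 1148 144674 16134593 16137768 144699) (v5 6054500 49297 4962 38999 4033830) (v5 6052984 4033800 37094 8137 49322) (v5 6054992 4033805 35824 7502 49337) (v5 6053476 49312 4327 40269 4033825)) (v5 (v5 32014 4033790 162192 165367 4033815) (v5 6053220 144679 35189 4103255 128082) (v5 6052344 128052 4101350 38364 144704) (v5 6052482 128057 4100080 38754 144719) (v5 6054731 144694 35579 4104525 128077)) (v5 (v5 1016 128042 4207 7382 128067) (v5 6055115 4033795 4099445 16137133 4192842) (v5 6054879 4192812 16135228 4102620 4033820) (v5 6053097 4192817 16133958 4103010 4033835) (v5 6052861 4033810 4099835 16138403 4192837)) (v5 (v5 33276 4192802 36459 39634 4192827) (v5 6053860 128047 16133323 167907 49332) (v5 6054239 49302 162827 16136498 128072) (v5 6053737 49307 164732 16136513 128087) (v5 6054116 128062 16133338 166002 49327)) (v5 (v5 391 49292 4100715 4103890 49317) (v5 6052605 4192807 164097 6747 144714) (v5 6053599 144684 3692 167272 4192832) (v5 6054352 144689 3572 166637 4192847) (v5 6052221 4192822 163462 6867 144709))) (v5 (v5 (v5 6116 113049 14118467 12153270 96948) (v5 5491 33674 4037087 6056126 48453) (v5 51603 6049801 4037717 40017 1823) (v5 4038487 32676 4323 54753 6050342) (v5 36849 4033937 6052959 56393 1198)) (v5 (v5 101372 33039 4162815 165745 6050070) (v5 36214 112676 6052319 150004 4128963) (v5 6052470 112051 4117222 38742 97079) (v5 35604 4096932 99579 6055506 128468) (v5 4038477 32051 4035827 120027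 96454)) (v5 (v5 12103628 4097295 4036457 6056011 4128822) (v5 4038482 6049922 4162945 12152260 4208973) (v5 4038497 4176937 14135233 4102998 6049697) (v5 4216 240072 6223 133508 1082) (v5 6053115 4033307 4131463 12122283 4208842)) (v5 (v5 22184888 192051 6053839 55383 176328) (v5 6053735 160052 16149455 136028 49083) (v5 37484 33301 4147954 40642 4144829) (v5 52233 6050562 101479 12135764 96338) (v5 52863 112439 14164715 118752 6050710)) (v5 (v5 180752 6050421 4116462 151014 1692) (v5 50973 4177310 4117092 54123 447) (v5 4841 160687 6052574 4104898 176459) (v5 6054355 160314 3698 150634 4224854) (v5 3591 192449 4132713 6055371 144334))) (v5 (v5 (v5 4987 96922 12149719 14121642 113074) (v5 4037742 6050301 52462 7498 32701) (v5 4352 48422 6054475 4040262 33699) (v5 38117 1177 51572 6056134 4033962) (v5 52472 1812 35826 4040892 6049826)) (v5 (v5 100243 6050044 162189 4165990 33064) (v5 36217 128427 6052445 102754 4096957) (v5 35592 4128932 148348 6055494 112701) (v5 4035852 96433 115201 4039002 32076) (v5 6054732 97068 35201 4120397 112076)) (v5 (v5 12102499 4128796 6053090 4039632 4097320) (v5 6232 1041 130317 9398 240097) (v5 4038372 4208942 12150604 4166120 6049947) (v5 6052847 4208821 12117457 4134638 4033332) (v5 4036482 6049686 4099457 14138408 4176962)) (v5 (v5 22183759 176302 52457 6057014 192076) (v5 52477 96297 12132573 104654 6050587) (v5 6054112 49052 130947 16152630 160077) (v5 52482 6050689 117101 14167890 112464) (v5 37492 4144818 36451 4151129 33326)) (v5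 (v5 179623 1666 147463 4119637 6050446) (v5 6052227 4224813 148093 6873 160339) (v5 52467 416 50942 4120267 4177335) (v5 5597 144313 6052580 4135888 192474) (v5 3717 176448 4100707 6055749 160712))) (v5 (v5 (v5 5477 96923 12150095 14121520 113077) (v5 53243 1798 36842 4040125 6049834) (v5 35851 1173 53218 6056642 4033950) (v5 6112 48428 6052951 4040130 33717) (v5 4037100 6050317 51578 8641 32699)) (v5 (v5 100733 6050045 162570 4165993 33067) (v5 6053219 97054 35567 4119005 112084) (v5 4035840 96429 116852 4038990 32064) (v5 35226 4128938 146829 6055632 112719) (v5 37726 128443 6052331 103897 4096955)) (v5 (v5 12102989 4128797 6052836 4040135 4097323) (v5 4038360 6049672 4099823 14137011 4176970) (v5 6055129 4208817 12119108 4134496 4033320) (v5 4036470 4208948 12149085 4166513 6049965) (v5 4232 1057 130333 7366 240095)) (v5 (v5 22184249 176303 52208 6056887 192079) (v5 36476 4144804 37467 4152907 33334) (v5 53233 6050685 115577 14167878 112452) (v5 6053864 49058 132853 16152768 160095) (v5 53238 96313 12132589 102622 6050585)) (v5 (v5 180113 1667 147839 4120140 6050449) (v5 3597 176434 4101723 6055377 160720) (v5 4842 144309 6052196 4136396 192462) (v5 53223 422 50948 4119635 4177353) (v5 6052599 4224829 147459 6741 160337))) (v5 (v5 (v5 4348 113052 14118345 12152894 96947) (v5 37119 4033925 6053467 54747 1202) (v5 4036980 32674 5466 55637 6050326) (v5 53487 6049809 4036950 39001 1837) (v5 4973 33692 4036955 6057650 48447)) (v5 (v5 99604 33042 4162818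 165364 6050069) (v5 4036965 32039 4035815 118376 96458) (v5 35214 4096930 100722 6055620 128452) (v5 6052356 112059 4115830 38376 97093) (v5 37729 112694 6052457 151523 4128957)) (v5 (v5 12101860 4097298 4036960 6056265 4128821) (v5 6054861 4033295 4131321 12120632 4208846) (v5 6248 240070 4191 133492 1066) (v5 4036970 4176945 14133836 4102632 6049711) (v5 4036985 6049940 4163338 12153779 4208967)) (v5 (v5 22183120 192054 6053712 55632 176327) (v5 52227 112427 14164703 120276 6050714) (v5 52857 6050560 99447 12135748 96322) (v5 36484 33309 4149732 39626 4144843) (v5 6054241 160070 16149593 134122 49077)) (v5 (v5 178984 6050424 4116965 150638 1691) (v5 3723 192437 4133221 6055755 144338) (v5 6053596 160312 3566 151268 4224838) (v5 5598 160695 6052202 4103882 176473) (v5 50967 4177328 4116460 54117 441)))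

table40 : Trie 4
table40 = v5 (v5 (v5 (v5 3 404 35309 38484 429) (v5 52865 49045 52210 54745 48450) (v5 51600 48420 52840 55385 49070) (v5 53485 48425 51570 54750 49085) (v5 52220 49060 51575 56015 48445)) (v5 (v5 384 48410 4099565 4102740 48435) (v5 51585 409 50935 4119131 4128960) (v5 50960 4128930 4117226 54110 434) (v5 50975 4128935 4115956 54125 449) (v5 53475 424 50950 4120401 4128955)) (v5 (v5 32769 4128920 51580 54755 4128945) (v5 53480 48415 4115321 41024 4208970) (v5 53495 4208940 35944 4118496 48440) (v5 51590 4208945 37849 4118886 48455) (v5 51605 48430 4115711 39119 4208965)) (v5 (v5 33404 4208930 52205 55380 4208955) (v5 52225 4128925 37214 4105280 49080) (v5 52855 49050 4100200 40389 4128950) (v5 52230 49055 4102105 39754 4128965) (v5 52860 4128940 36579 4103375 49075)) (v5 (v5 389 49040 4116591 4119766 49065) (v5 50970 4208935 4101470 54120 444) (v5 52215 414 50940 4104645 4208960) (v5 52845 419 50945 4104010 4208975) (v5 50965 4208950 4100835 54115 439))) (v5 (v5 (v5 3330 48033 35435 6480 54) (v5 53247 49298 52466 54873 48579) (v5 51982 48799 53346 55513 49199) (v5 53867 48678 51826 55003 49592) (v5 52602 49439 52081 56268 48952)) (v5 (v5 98586 6049539 4099691 101736 810) (v5 3960 144680 6052189 4135255 128337) (v5 6052214 4160809 148352 6860 112955) (v5 6052229 4112808 115455 6875 160472) (v5 5850 128693 6052204 4152026 112330)) (v5 (v5 12100842 128169 36085 4040139 96066) (v5 37858 4033796 146697 14152636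 192219) (v5 4038876 208063 12150608 102116 32819) (v5 4036971 224070 12117711 102131 32960) (v5 35983 4033433 130836 14122659 224218)) (v5 (v5 22182102 208179 36710 4040764 176076) (v5 4037606 128048 12148953 152029 33585) (v5 37233 4034431 163078 12104372 144203) (v5 36608 4034058 117355 12104387 112214) (v5 4038241 144065 12133092 134248 33454)) (v5 (v5 177966 6050169 4100966 134888 1440) (v5 6052224 4192808 132471 6870 144843) (v5 4590 128809 6052194 4120774 208337) (v5 5220 144564 6052199 4167767 192350) (v5 6052219 4240829 147712 6865 128584))) (v5 (v5 (v5 3579 28 3304 38610 48058) (v5 52994 49551 52717 55001 48703) (v5 51729 48548 53222 55641 49323) (v5 53614 48931 52077 55256 49464) (v5 52349 49188 51957 56521 48824)) (v5 (v5 98835 784 98560 4102866 6049564) (v5 6052714 160431 3559 118630 4112833) (v5 3584 128306 4132974 6055364 144705) (v5 3599 112309 4147830 6055379 128718) (v5 6054604 112944 3574 151527 4160834)) (v5 (v5 12101091 96040 4036583 39260 128194) (v5 4038864 32919 98815 12120886 224095) (v5 37999 192188 14150980 149872 4033821) (v5 36094 224197 14117833 134011 4033458) (v5 4036989 32808 98830 12153783 208088)) (v5 (v5 22182351 176050 4037208 39885 208204) (v5 36729 112173 12101071 120530 4034083) (v5 4038239 33554 147203 12152128 128073) (v5 4037614 33433 133232 12136267 144090) (v5 37364 144192 12101086 166253 4034456)) (v5 (v5 178215 1414 131967 4104141 6050194) (v5 3594 192309 4164846 6055374 144589) (v5 6053344 144812 3564 135646 4192833) (v5 6053974 128563 3569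 150887 4240854) (v5 3589 208326 4116583 6055369 128834))) (v5 (v5 (v5 3705 29 3305 38483 48061) (v5 53371 49174 52338 55124 48832) (v5 52106 48927 53093 55764 49452) (v5 53991 48554 51698 54879 49341) (v5 52726 49567 51828 56144 48701)) (v5 (v5 98961 785 98561 4102739 6049567) (v5 6052717 112930 3685 150130 4160842) (v5 3710 112305 4148851 6055742 128706) (v5 3725 128312 4132080 6055757 144723) (v5 6054607 160447 3700 119773 4112831)) (v5 (v5 12101217 96041 4036964 39133 128197) (v5 4038483 32794 98941 12152386 208096) (v5 37874 224193 14119484 133619 4033446) (v5 35969 192194 14149461 149510 4033839) (v5 4036608 32935 98956 12122029 224093)) (v5 (v5 22182477 176051 4037589 39758 208207) (v5 36604 144178 12101197 168031 4034464) (v5 4037858 33429 131073 12135875 144078) (v5 4037233 33560 148854 12151766 128091) (v5 37239 112189 12101212 118498 4034081)) (v5 (v5 178341 1415 131713 4104014 6050197) (v5 3720 208312 4117599 6055752 128842) (v5 6053347 128559 3690 151395 4240842) (v5 6053977 144818 3695 134884 4192851) (v5 3715 192325 4164592 6055747 144587))) (v5 (v5 (v5 3329 48036 35308 6479 53) (v5 53118 49427 52589 55252 48956) (v5 51853 48676 52969 55892 49576) (v5 53738 48807 51949 55132 49213) (v5 52473 49316 51704 56397 48573)) (v5 (v5 98585 6049542 4099564 101735 809) (v5 3959 128681 6052567 4151005 112334) (v5 6052592 4112806 116598 6734 160456) (v5 6052607 4160817 146955 6749 112969) (v5 5849 144698 6052582 4136149 128331)) (v5 (v5 12100841 128172 35958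 4039758 96065) (v5 37985 4033421 130444 14121008 224222) (v5 4038501 224068 12118854 101990 32944) (v5 4036596 208071 12149211 102005 32833) (v5 36110 4033814 146335 14154155 192213)) (v5 (v5 22182101 208182 36583 4040383 176075) (v5 4037231 144053 12132700 136407 33458) (v5 37360 4034056 115323 12104246 112198) (v5 36735 4034439 164856 12104261 144217) (v5 4037866 128066 12148591 150378 33579)) (v5 (v5 177965 6050172 4100839 135142 1439) (v5 6052602 4240817 148220 6744 128588) (v5 4589 144562 6052572 4168021 192334) (v5 5219 128817 6052577 4119758 208351) (v5 6052597 4192826 131709 6739 144837)))

table41 : Trie 4
table41 = v5 (v5 (v5 (v5 770 97046 12165973 12169148 97071) (v5 52993 1795 36589 4040126 6049704) (v5 51979 6049674 4038221 39764 1820) (v5 53741 6049679 4036951 39129 1835) (v5 52727 1810 35954 4041396 6049699)) (v5 (v5 48013 6049664 114689 117864 6049689) (v5 51713 97051 4036316 166257 4144836) (v5 51339 4144806 164352 4039491 97076) (v5 51231 4144811 163082 4039131 97091) (v5 53982 97066 4035956 167527 4144831)) (v5 (v5 32895 4144796 36084 39259 4144821) (v5 53608 6049669 162447 12168513 176466) (v5 53874 176436 12166608 165622 6049694) (v5 51846 176441 12165338 165512 6049709) (v5 52112 6049684 162337 12169783 176461)) (v5 (v5 1400 176426 4037586 4040761 176451) (v5 52353 4144801 12164703 120404 1830) (v5 53234 1800 115324 12167878 4144826) (v5 52486 1805 117229 12167768 4144841) (v5 53367 4144816 12164593 118499 1825)) (v5 (v5 14 1790 163717 166892 1815) (v5 51098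 176431 116594 38624 97086) (v5 52594 97056 35319 119769 176456) (v5 53101 97061 35449 119134 176471) (v5 51472 176446 115959 38494 97081))) (v5 (v5 (v5 3970 128673 12118346 12105642 144828) (v5 4038246 6050174 52716 7120 32829) (v5 6052854 4033801 37345 8135 49577) (v5 5860 48804 6052824 4040134 33464) (v5 36598 4034063 6052829 56143 820)) (v5 (v5 99226 4033413 114815 4118869 48564) (v5 6052839 48038 6052064 102376 144213) (v5 4036341 128053 4101601 54363 160457) (v5 51357 4160814 147332 4039509 128594) (v5 4038856 144569 51206 4136525 96076)) (v5 (v5 12101482 144045 6052834 55008 128322) (v5 53862 6049544 130571 12104632 208347) (v5 37873 4192813 36070 4150121 32945) (v5 6052844 208068 12149588 133758 48962) (v5 6052859 48683 146712 14153906 176086)) (v5 (v5 22182742 4240809 52461 8130 192204) (v5 4600 128174 12132827 4169037 49209) (v5 5230 49303 4100326 14120754 112199) (v5 4037611 4034436 133106 7750 112340) (v5 53242 4112813 12148968 150124 1450)) (v5 (v5 178606 49419 116090 103386 33570) (v5 35348 208184 148347 54248 112965) (v5 52597 144685 35445 135518 192335) (v5 37223 128814 51451 103006 224228) (v5 3340 224075 163713 6490 64))) (v5 (v5 (v5 5474 144802 12102091 12121521 128698) (v5 5489 33423 4037213 6055999 48829) (v5 4036984 32798 5464 55891 6050199) (v5 37989 799 51952 6056004 4034088) (v5 6053349 49566 3949 40520 4033826)) (v5 (v5 100730 48538 4115313 117990 4033438) (v5 51714 128553 4035938 150507 4160839) (v5 6052089 144182 100720 6055239 48063) (v5 4036359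 96055 4131704 54381 144594) (v5 4038859 160446 51332 4104776 128078)) (v5 (v5 12102986 128296 52087 6056009 144070) (v5 6054609 48921 130697 12152763 208093) (v5 53624 208316 12102976 133746 6049569) (v5 6052719 176065 14149710 149887 48708) (v5 36109 32934 4146960 39245 4192838)) (v5 (v5 22184246 192178 4579 55636 4240834) (v5 4037609 112299 5209 136281 4034461) (v5 5479 49178 4163576 12136002 128199) (v5 52359 1429 149108 12152143 4112838) (v5 5484 112188 14117213 4103501 49328)) (v5 (v5 180110 33544 99835 119265 49444) (v5 35474 224187 100465 54626 128839) (v5 36719 112934 51447 151522 208209) (v5 5469 43 3319 166888 224100) (v5 51094 192324 131962 38620 144710))) (v5 (v5 (v5 4985 144803 12102467 12121394 128701) (v5 6053997 49552 4960 39123 4033834) (v5 35979 795 52968 6056517 4034076) (v5 4038488 32804 3945 55129 6050217) (v5 4970 33439 4036959 6057147 48827)) (v5 (v5 100241 48539 4115694 117863 4033441) (v5 4036588 160432 51188 4103379 128086) (v5 4035963 96051 4133350 54489 144582) (v5 6052107 144188 99201 6055257 48081) (v5 53981 128569 4036334 151650 4160837)) (v5 (v5 12102497 128297 51833 6055887 144073) (v5 37859 32920 4146946 41023 4192846) (v5 6054627 176061 14150731 149495 48696) (v5 52096 208322 12101457 133884 6049587) (v5 6052737 48937 130583 12153906 208091)) (v5 (v5 22183757 192179 4955 55509 4240837) (v5 4975 112174 14117579 4105279 49336) (v5 53361 1425 146949 12151751 4112826) (v5 4980 49184 4165862 12136140 128217) (v5 4037863 112315 4575 134249 4034459)) (v5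 (v5 179621 33545 100211 119138 49447) (v5 51476 192310 132343 38498 144718) (v5 4965 39 3315 167396 224088) (v5 37224 112940 51073 150760 208227) (v5 35344 224203 99831 54244 128837))) (v5 (v5 (v5 5864 128676 12118219 12105266 144827) (v5 37370 4034051 6053342 55127 824) (v5 3974 48802 6053972 4040388 33448) (v5 6055117 4033809 35948 7124 49591) (v5 4037226 6050192 51954 8639 32823)) (v5 (v5 101120 4033416 114688 4118488 48563) (v5 4036591 144557 51314 4134879 96080) (v5 51213 4160812 148475 4039113 128578) (v5 4035981 128061 4100204 54507 160471) (v5 6055107 48056 6052082 103895 144207)) (v5 (v5 12103376 144048 6052712 55262 128321) (v5 6055112 48671 146320 14152885 176090) (v5 6055127 208066 12150731 133872 48946) (v5 36095 4192821 37848 4150135 32959) (v5 51858 6049562 130709 12106151 208341)) (v5 (v5 22184636 4240812 52334 7754 192203) (v5 52478 4112801 12148576 152283 1454) (v5 4037861 4034434 131074 8384 112324) (v5 4604 49311 4102104 14120388 112213) (v5 5234 128192 12132965 4166751 49203)) (v5 (v5 180500 49422 115963 103010 33569) (v5 3344 224063 164221 6494 68) (v5 36720 128812 51069 103640 224212) (v5 53098 144693 35323 135137 192349) (v5 35470 208202 147585 54622 112959)))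

table42 : Trie 4
table42 = v5 (v5 (v5 (v5 1019 128420 12133841 12137016 128445) (v5 53121 6050299 4037591 39249 1074) (v5 51728 1044 37344 4040766 6050324) (v5 53992 1049 36074 4040131 6050339) (v5 52599 6050314 4036956 40519 1069)) (v5 (v5 8 1034 130310 133485 1059) (v5 51841 128425 35439 134125 96330) (v5 51088 96300 132220 38614 128450) (v5 51482 96305 130950 38504 128465) (v5 53854 128440 35329 135395 96325)) (v5 (v5 764 96290 4036586 4039761 96315) (v5 53736 1039 130315 12136381 4224846) (v5 53623 4224816 12134476 133490 1064) (v5 52097 4224821 12133206 133505 1079) (v5 51984 1054 130330 12137651 4224841)) (v5 (v5 33530 4224806 36709 39884 4224831) (v5 52481 96295 12132571 136025 6050334) (v5 52983 6050304 130945 12135746 96320) (v5 52737 6050309 132850 12135761 96335) (v5 53239 96310 12132586 134120 6050329)) (v5 (v5 48018 6050294 131585 134760 6050319) (v5 51226 4224811 132215 4039126 128460) (v5 52343 128430 4036321 135390 4224836) (v5 53352 128435 4035951 134755 4224851) (v5 51344 4224826 131580 4039496 128455))) (v5 (v5 (v5 4610 144549 12150223 14122024 112950) (v5 5240 49424 6053464 4040129 32955) (v5 4036981 6049549 53096 7760 33449) (v5 37863 4033806 6052699 54878 1460) (v5 6053474 4034441 36080 8390 48574)) (v5 (v5 99866 48663 130566 133613 32814) (v5 35963 128678 51441 134253 112209) (v5 35338 128179 116725 54238 128579) (v5 3350 128058 131206 6500 74) (v5 53857 128819 35455 103646 128332)) (v5 (v5 12102122 4112793 52086 7130 144198) (v5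 4038861 4033418 146447 9020 192345) (v5 5870 208189 12118981 4134620 48947) (v5 51972 4192818 12133462 101756 830) (v5 3980 48809 4099711 12105902 192214)) (v5 (v5 22183382 224055 6053459 55633 208332) (v5 6053479 144050 12148703 104276 49587) (v5 53237 6050179 115450 14152001 112325) (v5 6053484 49308 148982 12104012 96086) (v5 37238 4160819 36705 4167132 33580)) (v5 (v5 179246 4034043 147967 4151391 49194) (v5 51352 4240814 164348 4039504 160467) (v5 6053469 48043 6052069 151394 224213) (v5 4038226 144690 51201 4120139 176096) (v5 4036346 208073 4100961 54368 144838))) (v5 (v5 (v5 4219 112924 14118468 12153398 144574) (v5 37369 1419 52592 6055874 4033831) (v5 4224 32924 4037843 6056639 49449) (v5 6054614 48553 4194 39255 4034466) (v5 4037604 33438 4199 56271 6049574)) (v5 (v5 99475 32788 130692 133741 48688) (v5 4209 33 3309 134381 128083) (v5 35464 112178 132602 54616 128703) (v5 51104 128311 99450 38630 128844) (v5 37979 128568 51457 119900 128204)) (v5 (v5 12101731 144172 4204 55261 4112818) (v5 53609 789 98565 12136637 4192843) (v5 4038879 192314 3939 149622 4033443) (v5 4214 192193 12101706 4102886 48834) (v5 4229 48936 4131334 12122156 208214)) (v5 (v5 22182991 208306 52712 6056634 224080) (v5 6053354 96045 12100821 152157 49333) (v5 6053984 49556 99195 12151878 144075) (v5 36734 33559 4165481 39880 4160844) (v5 52989 112314 14148840 118625 6050204)) (v5 (v5 178855 49168 4148465 151142 4034068) (v5 4036354 176055 4117218 54376 144715) (v5 52344 160436 4035943 167523 4240839)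 (v5 4038229 144817 51327 4104136 208098) (v5 6052094 224202 147838 6055244 48068))) (v5 (v5 (v5 6240 112925 14118849 12153271 144577) (v5 4037868 33424 4585 54874 6049582) (v5 6052732 48549 5215 39763 4034454) (v5 6235 32930 4036954 6055882 49467) (v5 36599 1435 51703 6057647 4033829)) (v5 (v5 101496 32789 130438 133614 48691) (v5 35964 128554 51063 118503 128212) (v5 51466 128307 100471 38488 128832) (v5 35354 112184 131078 54254 128721) (v5 6225 49 3325 135524 128081)) (v5 (v5 12103752 144173 3955 55134 4112821) (v5 6230 48922 4131445 12120759 208222) (v5 6245 192189 12102727 4102744 48822) (v5 4036593 192320 5845 149760 4033461) (v5 52111 805 98581 12137780 4192841)) (v5 (v5 22185012 208307 52458 6056512 224083) (v5 52731 112300 14148826 120403 6050212) (v5 37234 33555 4163957 40388 4160832) (v5 6053362 49562 101101 12152016 144093) (v5 6053992 96061 12100837 150125 49331)) (v5 (v5 180876 49169 4148216 151015 4034071) (v5 6052102 224188 148219 6055252 48076) (v5 4037218 144813 51193 4104644 208086) (v5 53351 160442 4036329 166761 4240857) (v5 4035968 176071 4116964 54494 144713))) (v5 (v5 (v5 5224 144552 12150096 14121643 112949) (v5 6054497 4034429 36588 7369 48578) (v5 36105 4033804 6054472 55767 1444) (v5 4038491 6049557 51699 7374 33463) (v5 4594 49442 6052707 4041018 32949)) (v5 (v5 100480 48666 130439 133867 32813) (v5 51838 128807 35313 102625 128336) (v5 3334 128056 132349 6484 58) (v5 35480 128187 115328 54632 128593) (v5 37980 128696 51079 135777 112203)) (v5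 (v5 12102736 4112796 51959 7379 144197) (v5 5854 48797 4099569 12104881 192218) (v5 53748 4192816 12134605 101740 814) (v5 3964 208197 12117584 4134509 48961) (v5 4036611 4033436 146585 7114 192339)) (v5 (v5 22183996 224058 6053337 55887 208331) (v5 36730 4160807 37213 4168656 33584) (v5 6054487 49306 146950 12103996 96070) (v5 52483 6050187 117228 14152015 112339) (v5 6054492 144068 12148841 102370 49581)) (v5 (v5 179860 4034046 147840 4151640 49193) (v5 4035976 208061 4101469 54502 144842) (v5 4037221 144688 51319 4120393 176080) (v5 6054477 48051 6052077 151013 224227) (v5 51218 4240832 163586 4039118 160461)))

table43 : Trie 4
table43 = v5 (v5 (v5 (v5 1145 144296 12118345 12121520 144321) (v5 53244 6050677 4037216 39124 1200) (v5 52107 1170 37219 4040391 6050702) (v5 53613 1175 35949 4039756 6050717) (v5 52476 6050692 4036581 40394 1195)) (v5 (v5 9 1160 146186 149361 1185) (v5 51964 144301 35314 118629 96456) (v5 51467 96426 116724 38489 144326) (v5 51103 96431 115454 38629 144341) (v5 53731 144316 35454 119899 96451)) (v5 (v5 765 96416 4036961 4040136 96441) (v5 53859 1165 114819 12120885 4208844) (v5 54002 4208814 12118980 117994 1190) (v5 51718 4208819 12117710 117884 1205) (v5 51861 1180 114709 12122155 4208839)) (v5 (v5 33403 4208804 36584 39759 4208829) (v5 52604 96421 12117075 151901 6050712) (v5 53362 6050682 146821 12120250 96446) (v5 52358 6050687 148726 12120140 96461) (v5 53116 96436 12116965 149996 6050707)) (v5 (v5 48021 6050672 116089 119264 6050697)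 (v5 51349 4208809 148091 4039501 144336) (v5 52722 144306 4035946 151266 4208834) (v5 52973 144311 4036326 150631 4208849) (v5 51221 4208824 147456 4039121 144331))) (v5 (v5 (v5 5225 128799 12134097 14153271 160452) (v5 6054119 4034048 36715 7495 48957) (v5 35978 4033423 6054094 55638 1445) (v5 4038866 6049554 52076 7500 33590) (v5 4595 49313 6052704 4041399 32824)) (v5 (v5 100481 48789 146442 149489 32940) (v5 51967 144554 35440 102751 112335) (v5 3335 144055 148602 6485 59) (v5 35353 128184 147082 54253 144848) (v5 37853 144695 51456 135523 144208)) (v5 (v5 12102737 4160799 51836 7505 112194) (v5 5855 48668 4099696 12105007 224223) (v5 53877 4240819 12150858 101741 815) (v5 3965 208194 12149338 4150511 48584) (v5 4036986 4033811 114835 7115 208342)) (v5 (v5 22183997 208053 6053334 55508 192330) (v5 36603 4112798 37340 4121409 33459) (v5 6054109 49429 131201 12103997 96071) (v5 52612 6050184 164983 14120769 128342) (v5 6054114 128063 12117091 102371 49204)) (v5 (v5 179861 4034421 131841 4135890 49572) (v5 4036351 224060 4101596 54373 128589) (v5 4037596 128683 51196 4168402 176081) (v5 6054099 48048 6052074 134883 192224) (v5 51347 4192823 116085 4039499 112960))) (v5 (v5 (v5 6114 160426 14150345 12137272 128824) (v5 4038249 33549 4584 55251 6049579) (v5 6052729 48926 5214 39890 4034073) (v5 6109 32803 4036573 6055879 49338) (v5 36724 1434 52082 6057269 4033448)) (v5 (v5 101370 32914 146568 149617 48814) (v5 36089 144807 51442 150257 128209) (v5 51089 112304 100470 38615 144579)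 (v5 35479 144187 131332 54631 144720) (v5 6099 48 3324 151777 144080)) (v5 (v5 12103626 112168 3954 55011 4160824) (v5 6104 48543 4147195 12152513 208219) (v5 6119 224192 12102726 4102871 48693) (v5 4036974 208321 5844 118010 4033836) (v5 51734 804 98580 12154033 4240844)) (v5 (v5 22184886 192304 52587 6056509 208078) (v5 52354 128301 14117198 168158 6050209) (v5 37359 33428 4115948 40515 4112823) (v5 6053359 49183 101100 12120266 128088) (v5 6053989 96060 12100836 134376 49454)) (v5 (v5 180750 49546 4132339 135016 4034446) (v5 6052099 192183 132597 6055249 48073) (v5 4037599 128558 51322 4104771 224085) (v5 52974 112939 4035948 119260 4192848) (v5 4036349 176070 4164211 54371 128708))) (v5 (v5 (v5 4345 160427 14150096 12137145 128827) (v5 37244 1420 52463 6055877 4033456) (v5 4350 32799 4038224 6057017 49326) (v5 6054617 48932 4320 39128 4034091) (v5 4037223 33565 4325 56394 6049577)) (v5 (v5 99601 32915 146314 149490 48817) (v5 4335 34 3310 150380 144088) (v5 35339 144183 132348 54239 144708) (v5 51481 112310 99576 38503 144597) (v5 37854 144823 51078 151400 128207)) (v5 (v5 12101857 112169 4330 54884 4160827) (v5 53986 790 98566 12152636 4240852) (v5 4038498 208317 3940 117868 4033824) (v5 4340 224198 12101832 4102759 48711) (v5 4355 48559 4147336 12153656 208217)) (v5 (v5 22183117 192305 52333 6057012 208081) (v5 6053357 96046 12100822 136154 49462) (v5 6053987 49179 99196 12120124 128076) (v5 36609 33434 4118234 39753 4112841) (v5 53366 128317 14117594 166126 6050207)) (v5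 (v5 178981 49547 4132715 134889 4034449) (v5 4035973 176056 4165227 54499 128716) (v5 52721 112935 4036324 119768 4192836) (v5 4037848 128564 51198 4104009 224103) (v5 6052097 192199 131708 6055247 48071))) (v5 (v5 (v5 4609 128802 12133970 14153520 160451) (v5 5239 49301 6053842 4039748 32828) (v5 4036606 6049552 53219 7759 33574) (v5 37990 4033431 6052702 55257 1459) (v5 6053852 4034066 35953 8389 48951)) (v5 (v5 99865 48792 146315 149743 32939) (v5 36090 144683 51064 134507 144212) (v5 35465 128182 148225 54617 144832) (v5 3349 144063 147205 6499 73) (v5 53728 144572 35328 103645 112329)) (v5 (v5 12102121 4160802 51709 7129 112193) (v5 4038486 4033799 114693 9019 208346) (v5 5869 208192 12150481 4150370 48568) (v5 51843 4240827 12149461 101755 829) (v5 3979 48686 4099584 12105901 224217)) (v5 (v5 22183381 208056 6053837 55762 192329) (v5 6053857 128051 12116949 104275 49208) (v5 53108 6050182 162951 14120373 128326) (v5 6053862 49437 132979 12104011 96085) (v5 37365 4112816 36578 4119123 33453)) (v5 (v5 179245 4034424 131714 4135514 49571) (v5 51223 4192811 116593 4039123 112964) (v5 6053847 48046 6052072 135772 192208) (v5 4037851 128691 51324 4167386 176095) (v5 4035971 224078 4100834 54497 128583)))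

table44 : Trie 4
table44 = v5 (v5 (v5 (v5 769 96920 12118220 12121395 96945) (v5 53372 1669 36714 4039751 6050082) (v5 51856 6050052 4037846 39889 1694) (v5 53864 6050057 4036576 39254 1709) (v5 52348 1684 36079 4041021 6050077)) (v5 (v5 48016 6050042 162317 165492 6050067) (v5 52092 96925 4035941 118504 4128834) (v5 51216 4128804 116599 4039116 96950) (v5 51354 4128809 115329 4039506 96965) (v5 53603 96940 4036331 119774 4128829)) (v5 (v5 32768 4128794 35959 39134 4128819) (v5 53987 6050047 114694 12120760 176340) (v5 53751 176310 12118855 117869 6050072) (v5 51969 176315 12117585 118009 6050087) (v5 51733 6050062 114834 12122030 176335)) (v5 (v5 1399 176300 4037211 4040386 176325) (v5 52732 4128799 12116950 168032 1704) (v5 53111 1674 162952 12120125 4128824) (v5 52609 1679 164857 12120265 4128839) (v5 52988 4128814 12117090 166127 1699)) (v5 (v5 13 1664 115964 119139 1689) (v5 51477 176305 164222 38499 96960) (v5 52471 96930 35444 167397 176330) (v5 53224 96935 35324 166762 176345) (v5 51093 176320 163587 38619 96955))) (v5 (v5 (v5 5865 144675 12149973 12105267 128574) (v5 37243 4034426 6053339 54998 825) (v5 3975 48673 6053969 4040769 33575) (v5 6054739 4033428 36075 7125 49214) (v5 4037601 6050189 51831 8765 32950)) (v5 (v5 101121 4033791 162443 4166497 48942) (v5 4036966 128804 51191 4150756 96081) (v5 51342 4112803 132476 4039494 144833) (v5 4036356 144060 4100331 54378 112970) (v5 6054729 48053 6052079 104021 112204)) (v5 (v5 12103377 128043 6052709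 54883 112320) (v5 6054734 48794 114820 14121389 176091) (v5 6054749 224065 12134732 133618 48569) (v5 35968 4240824 37975 4134260 32834) (v5 51987 6049559 146462 12106277 192340)) (v5 (v5 22184637 4192803 52711 7755 224208) (v5 52607 4160804 12117076 136153 1455) (v5 4038236 4034053 147077 8385 128327) (v5 4605 49434 4102231 14152391 144218) (v5 5235 128189 12148718 4119504 49582)) (v5 (v5 180501 49293 147717 103011 33444) (v5 3345 208058 116720 6495 69) (v5 36593 144559 51446 103641 192209) (v5 53227 128688 35450 150759 208352) (v5 35343 208199 131836 54243 160462))) (v5 (v5 (v5 4859 128548 12102341 12153148 144700) (v5 6053994 49173 4834 39250 4033453) (v5 36104 794 53347 6056514 4034451) (v5 4038869 32929 3944 55006 6050214) (v5 4844 33564 4036578 6057144 48698)) (v5 (v5 100115 48916 4162941 165618 4033816) (v5 4036969 112929 51317 4103506 144085) (v5 4036344 96050 4149100 54366 128829) (v5 6052104 112183 99200 6055254 48078) (v5 53604 144822 4035953 135651 4112828)) (v5 (v5 12102371 112294 51962 6055884 128068) (v5 37984 32793 4131069 41150 4240849) (v5 6054624 176060 14119103 117995 48819) (v5 51719 192319 12101456 149637 6049584) (v5 6052734 48558 130837 12137907 224090)) (v5 (v5 22183631 224182 4829 55886 4192828) (v5 4849 144177 14149075 4105406 49459) (v5 52984 1424 131327 12120251 4160829) (v5 4854 49561 4117853 12151893 128214) (v5 4038244 128316 4574 150252 4034078)) (v5 (v5 179495 33418 100085 150892 49318) (v5 51099 208311 148473 38625 128713) (v5 4839 38 3314 119895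 208083) (v5 37349 160441 51452 135011 208224) (v5 35469 192198 99830 54621 144584))) (v5 (v5 (v5 5600 128549 12102092 12153021 144703) (v5 5615 33550 4037594 6056377 48706) (v5 4036603 32925 5590 55514 6050202) (v5 37864 800 51823 6056382 4034469) (v5 6053352 49189 3950 40393 4033451)) (v5 (v5 100856 48917 4163322 165491 4033819) (v5 52091 144808 4036319 134254 4112836) (v5 6052092 112179 100846 6055242 48066) (v5 4035978 96056 4147581 54504 128847) (v5 4038478 112945 51203 4104649 144083)) (v5 (v5 12103112 112295 51708 6056387 128071) (v5 6054612 48544 130443 12136510 224098) (v5 54001 192315 12103102 149745 6049572) (v5 6052722 176066 14118214 117883 48837) (v5 35984 32809 4131085 39118 4240847)) (v5 (v5 22184372 224183 4580 55759 4192831) (v5 4037228 128302 5210 152030 4034086) (v5 5605 49557 4116329 12152001 128202) (v5 52736 1430 132978 12120139 4160847) (v5 5610 144193 14149216 4103374 49457)) (v5 (v5 180236 33419 99836 150765 49321) (v5 35349 192184 100466 54249 144592) (v5 36594 160437 51068 135519 208212) (v5 5595 44 3320 119133 208101) (v5 51471 208327 147584 38493 128711))) (v5 (v5 (v5 3969 144678 12149846 12105516 128573) (v5 4037871 6050177 52339 7119 32954) (v5 6053232 4033426 37218 8009 49198) (v5 5859 48681 6053202 4039753 33589) (v5 36725 4034444 6053207 56522 819)) (v5 (v5 99225 4033794 162316 4166116 48941) (v5 6053217 48041 6052067 102375 112208) (v5 4035966 144058 4101474 54492 112954) (v5 51228 4112811 131079 4039128 144847) (v5 4038481 128822 51329 4152275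 96075)) (v5 (v5 12101481 128046 6053212 55137 112319) (v5 53733 6049547 146570 12104631 192344) (v5 38000 4240822 35943 4134244 32818) (v5 6053222 224073 12133335 134012 48583) (v5 6053237 48812 114708 14122278 176085)) (v5 (v5 22182741 4192806 52584 8004 224207) (v5 4599 128177 12148826 4121028 49586) (v5 5229 49432 4100199 14152250 144202) (v5 4037236 4034061 148855 7749 128341) (v5 53113 4160822 12116964 134502 1449)) (v5 (v5 178605 49296 147590 103260 33443) (v5 35475 208187 132344 54627 160466) (v5 52468 128686 35318 151648 208336) (v5 37350 144567 51074 103005 192223) (v5 3339 208076 115958 6489 63)))

table : Trie 6
table = v5 (v5 table00 table01 table02 table03 table04) (v5 table10 table11 table12 table13 table14) (v5 table20 table21 table22 table23 table24) (v5 table30 table31 table32 table33 table34) (v5 table40 table41 table42 table43 table44)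

decodeVector : ℕ → Vec3
decodeVector n = n mod 5 ∷ (n / 5) mod 5 ∷ (n / 25) mod 5 ∷ []

decodeDigits : (fuel : ℕ) → ℕ → List ℕ
decodeDigits zero _ = []
decodeDigits (suc fuel) zero = []
decodeDigits (suc fuel) n@(suc _) = n % 126 ∸ 1 ∷ decodeDigits fuel (n / 126)

length-decodeDigits : ∀ fuel n → length (decodeDigits fuel n) ≤ fuel
length-decodeDigits zero _ = z≤n
length-decodeDigits (suc fuel) zero = z≤n
length-decodeDigits (suc fuel) (suc n) = s≤s (length-decodeDigits fuel _)

opaque
  tableEntry : SymCoords → ℕ
  tableEntry = lookupTrie table

decomposition : SymCoords → List Vec3
decomposition k = map decodeVector (decodeDigits 4 (tableEntry k))

rank : SymCoords → ℕ
rank k = length (decomposition k)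

rank≤4 : ∀ k → rank k ≤ 4
rank≤4 k rewrite length-map decodeVector (decodeDigits 4 (tableEntry k)) =
  length-decodeDigits 4 (tableEntry k)

Decomposes : SymCoords → Set
Decomposes k = All NonZeroVec (decomposition k) × sumOuter (decomposition k) ≡ fromSymCoords k

RankStepBounded : SymCoords → Set
RankStepBounded k =
  3 ≤ rank k ⊎ All (λ u → rank (symCoords (outer u +M fromSymCoords k)) ≤ suc (rank k)) (vectors 3)

_≟ᵥ_ : ∀ {n} → DecidableEquality (Vec F₅ n)
_≟ᵥ_ = Vec.≡-dec Fin._≟_

decomposes? : ∀ k → Dec (Decomposes k)
decomposes? k =
  all? (λ u → ¬? (u ≟ᵥ replicate 3 0F)) (decomposition k)
    ×-dec Vec.≡-dec _≟ᵥ_ (sumOuter (decomposition k)) (fromSymCoords k)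

rankStepBounded? : ∀ k → Dec (RankStepBounded k)
rankStepBounded? k =
  3 ≤? rank k
    ⊎-dec all? (λ u → rank (symCoords (outer u +M fromSymCoords k)) ≤? suc (rank k)) (vectors 3)

opaque
  unfolding tableEntry

  rank-zero : rank (symCoords zeroMat) ≡ 0
  rank-zero = refl

  all-decompose : All Decomposes (vectors 6)
  all-decompose = all-isYes⇒All decomposes? (vectors 6) _

  all-rankStepBounded : All RankStepBounded (vectors 6)
  all-rankStepBounded = all-isYes⇒All rankStepBounded? (vectors 6) _

decomposes : ∀ k → Decomposes k
decomposes k = All.lookup all-decompose (∈-vectors k)

symRankOf : Mat3 → ℕ
symRankOf X = rank (symCoords X)

-- symCoords only reads the upper triangle, so outer u +M X and outer u +M fromSymCoords (symCoords X)
-- have the same coordinates by computation.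
symRankOf-step : ∀ u X → symRankOf (outer u +M X) ≤ suc (symRankOf X)
symRankOf-step u X = step (All.lookup all-rankStepBounded (∈-vectors (symCoords X)))
  where
  step : RankStepBounded (symCoords X) → symRankOf (outer u +M X) ≤ suc (symRankOf X)
  step (inj₁ 3≤r) = ≤-trans (rank≤4 _) (s≤s 3≤r)
  step (inj₂ bounded) = All.lookup bounded (∈-vectors u)

sumOfSimple-symRankOf : ∀ {X} → Symmetric X → SumOfSimple (symRankOf X) X
sumOfSimple-symRankOf {X} S =
  decomposition k , refl , proj₁ (decomposes k) , trans (proj₂ (decomposes k)) (fromSymCoords-symCoords S)
  where k = symCoords X

symRank-symRankOf : ∀ {X} → Symmetric X → SymRank X (symRankOf X)
symRank-symRankOf S =
  symRank-intro (sumOfSimple-symRankOf S) (sumOfSimple-lowerBound symRankOf rank-zero symRankOf-step)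

fromSymCoords-symRank : ∀ {k r} → rank k ≡ r → Symmetric (fromSymCoords k) × SymRank (fromSymCoords k) r
fromSymCoords-symRank {k} refl =
  S , subst (SymRank (fromSymCoords k)) (cong rank (symCoords-fromSymCoords k)) (symRank-symRankOf S)
  where S = fromSymCoords-symmetric k

hasRank? : ∀ r k → Dec (rank k ≡ r)
hasRank? r k = rank k ≟ r

withRank : ℕ → List Mat3
withRank r = map fromSymCoords (filter (hasRank? r) (vectors 6))

numberWithSymRank : ∀ {r n} → length (withRank r) ≡ n → NumberWithSymRank r n
numberWithSymRank {r} count =
  withRank r , count , Unique.map⁺ fromSymCoords-injective (Unique.filter⁺ (hasRank? r) (vectors-unique 6))
  , λ X → mk⇔ listed⇒symRank symRank⇒listed
  where
  listed⇒symRank : ∀ {X} → X ∈ withRank r → Symmetric X × SymRank X r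
  listed⇒symRank X∈ =
    let k , k∈ , X≡k = ∈-map⁻ fromSymCoords X∈
    in subst (λ Y → Symmetric Y × SymRank Y r) (sym X≡k)
         (fromSymCoords-symRank (proj₂ (∈-filter⁻ (hasRank? r) {xs = vectors 6} k∈)))

  symRank⇒listed : ∀ {X} → Symmetric X × SymRank X r → X ∈ withRank r
  symRank⇒listed (S , rankX) = ∈-map∘filter⁺ fromSymCoords (hasRank? r) {xs = vectors 6}
    (_ , ∈-vectors _ , sym (fromSymCoords-symCoords S) , symRank-unique (symRank-symRankOf S) rankX)

opaque
  unfolding tableEntry

  withRank-counts : length (withRank 0) ≡ 1 × length (withRank 1) ≡ 62 × length (withRank 2) ≡ 1922
    × length (withRank 3) ≡ 7440 × length (withRank 4) ≡ 6200
  withRank-counts = refl , refl , refl , refl , refl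

mainTheorem3 :
    ((X : Mat3) → Symmetric X → ∃ λ r → r ≤ 4 × SymRank X r)
    × NumberWithSymRank 0 1
    × NumberWithSymRank 1 62
    × NumberWithSymRank 2 1922
    × NumberWithSymRank 3 7440
    × NumberWithSymRank 4 6200
mainTheorem3 =
  let c₀ , c₁ , c₂ , c₃ , c₄ = withRank-counts in
  (λ X S → symRankOf X , rank≤4 (symCoords X) , symRank-symRankOf S)
  , numberWithSymRank c₀ , numberWithSymRank c₁ , numberWithSymRank c₂
  , numberWithSymRank c₃ , numberWithSymRank c₄
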